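{- Let $G$ be a (multiplicative) abelian group and let $k,\ell\ge1$ be integers. For every $\vec r\in\mathbb Z_{\ge1}^k$, $\vec w=(w_1,\dots,w_k)\in G^k$, $\vec s\in\mathbb Z_{\ge1}^\ell$, $\vec z=(z_1,\dots,z_\ell)\in G^\ell$, the following identity holds in $(\mathcal H(\mathbb Z_{\ge1}\times G),\sqcup\!\sqcup_\eta)$: $$\binom{\vec r}{\vec w}\sqcup\!\sqcup_\eta\binom{\vec s}{\vec z}=\sum_{(\varphi,\psi)\in I_{k,\ell}}\ \sum_{\substack{\vec t\in\mathbb Z_{\ge1}^{k+\ell}\\ |\vec t|=|\vec r|+|\vec s|}} c_{\vec r,\vec s}^{\vec t,(\varphi,\psi)}\binom{\vec t}{\vec w\,\overline{\sqcup\!\sqcup}_{(\varphi,\psi)}\vec z}.$$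
   Context: Words and the algebra: an element of the free monoid on $\mathbb Z_{\ge1}\times G$ is written $\binom{s_1,\dots,s_k}{b_1,\dots,b_k}$ (the word $(s_1,b_1)\cdots(s_k,b_k)$); the empty word is $1$; $\mathcal H(\mathbb Z_{\ge1}\times G)$ is the free abelian group on these words. Let $x_0$ and $x_b$ ($b\in G$) be pairwise distinct letters (indexed by the disjoint union $\{0\}\sqcup G$) and $\sqcup\!\sqcup$ the shuffle product on the free abelian group of words in them: $1\sqcup\!\sqcup w=w\sqcup\!\sqcup1=w$, $(a_1u)\sqcup\!\sqcup(b_1v)=a_1(u\sqcup\!\sqcup b_1v)+b_1(a_1u\sqcup\!\sqcup v)$. The span $\mathcal H_1$ of $1$ and words ending in some $x_b$ ($b\in G$) is closed under $\sqcup\!\sqcup$ and has basis $1$ and $x_0^{s_1-1}x_{b_1}\cdots x_0^{s_k-1}x_{b_k}$. Let $\eta:\mathcal H_1\to\mathcal H(\mathbb Z_{\ge1}\times G)$ be the linear bijection $x_0^{s_1-1}x_{b_1}\cdots x_0^{s_k-1}x_{b_k}\mapsto\binom{s_1,\,s_2,\dots,\,s_k}{1/b_1,\,b_1/b_2,\dots,\,b_{k-1}/b_k}$, $1\mapsto1$, and $u\sqcup\!\sqcup_\eta v=\eta(\eta^{ -1}(u)\sqcup\!\sqcup\eta^{ -1}(v))$. Coefficients: $[k]=\{1,\dots,k\}$; $I_{k,\ell}$ is the set of pairs $(\varphi,\psi)$ of order-preserving injective maps $\varphi:[k]\to[k+\ell]$, $\psi:[\ell]\to[k+\ell]$ with $\mathrm{im}\,\varphi\sqcup\mathrm{im}\,\psi=[k+\ell]$;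 $|\vec x|$ is the sum of entries. For $\vec t\in\mathbb Z_{\ge1}^{k+\ell}$ with $|\vec t|=|\vec r|+|\vec s|$, put $h_i=r_j$ if $i=\varphi(j)$, $h_i=s_j$ if $i=\psi(j)$; $\varepsilon(i)=1$ if $i\in\mathrm{im}\,\varphi$ and $-1$ otherwise; $c(i)=\binom{t_i-1}{h_i-1}$ if $i=1$ or ($i\ge2$ and $\varepsilon(i)=\varepsilon(i-1)$), and $c(i)=\binom{t_i-1}{\sum_{j\le i}t_j-\sum_{j\le i}h_j}$ if $i\ge2$ and $\varepsilon(i)\neq\varepsilon(i-1)$, where for integers $a\ge0,b$, $\binom ab$ is the usual binomial coefficient if $0\le b\le a$ and $0$ otherwise; $c_{\vec r,\vec s}^{\vec t,(\varphi,\psi)}=\prod_{i=1}^{k+\ell}c(i)$. The vector $\vec w\,\overline{\sqcup\!\sqcup}_{(\varphi,\psi)}\vec z\in G^{k+\ell}$ has $i$-th entry: $w_j$ if $i=\varphi(j)$ and ($i=1$ or $i-1\in\mathrm{im}\,\varphi$); $z_j$ if $i=\psi(j)$ and ($i=1$ or $i-1\in\mathrm{im}\,\psi$); $\frac{w_1\cdots w_j}{z_1\cdots z_{i-j}}$ if $i=\varphi(j)$ and $i-1\in\mathrm{im}\,\psi$; $\frac{z_1\cdots z_j}{w_1\cdots w_{i-j}}$ if $i=\psi(j)$ and $i-1\in\mathrm{im}\,\varphi$. -}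

module Defs where

open import Level using (Level; _⊔_)
open import Algebra.Bundles using (AbelianGroup)
open import Data.Nat using (ℕ; zero; suc; _∸_) renaming (_*_ to _*ℕ_)
open import Data.Nat.Combinatorics using (_C_)
open import Data.Integer as ℤ using (ℤ; +_; -[1+_])
open import Data.Bool using (Bool; true; false; if_then_else_)
open import Data.Maybe using (Maybe; just; nothing)
open import Data.Product using (_×_; _,_)
open import Data.List using (List; []; _∷_; _++_; map; concatMap; replicate; upTo)
open import Data.Nat.ListAction using (sum)
open import Data.List.Relation.Binary.Pointwise using (Pointwise)
open import Relation.Binary.PropositionalEquality using (_≡_)

-- Binomial coefficient with integer lower entry: the usual value if
-- 0 ≤ b ≤ a, and 0 otherwise (stdlib's  a C b  is already 0 for b > a).

binomℤ : ℕ → ℤ → ℕ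
binomℤ a (+ b)     = a C b
binomℤ a -[1+ _ ]  = 0

-- All lists of length n of positive integers with sum N, i.e. the set
-- { t ∈ ℤ≥1^n : |t| = N }, each listed exactly once.

compositions : ℕ → ℕ → List (List ℕ)
compositions zero zero    = [] ∷ []
compositions zero (suc _) = []
compositions (suc n) N    =
  concatMap (λ a → map (suc a ∷_) (compositions n (N ∸ suc a))) (upTo N)

-- I_{k,ℓ}: a pair (φ,ψ) of order-preserving injections with
-- im φ ⊔ im ψ = [k+ℓ] is uniquely determined by its sign sequence
-- ε(1) … ε(k+ℓ)  (true = "i ∈ im φ", i.e. ε(i)=1; false = "i ∈ im ψ").
-- interleavings k ℓ lists every Bool sequence with k trues and ℓ falses
-- exactly once, i.e. enumerates I_{k,ℓ}.

interleavings : ℕ → ℕ → List (List Bool)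
interleavings zero    zero    = [] ∷ []
interleavings zero    (suc l) = map (false ∷_) (interleavings zero l)
interleavings (suc k) zero    = map (true ∷_) (interleavings k zero)
interleavings (suc k) (suc l) =
  map (true ∷_) (interleavings k (suc l)) ++ map (false ∷_) (interleavings (suc k) l)

-- The coefficient c_{r,s}^{t,(φ,ψ)} = ∏_i c(i).
-- Running state: prev = ε(i-1) (nothing for i = 1),
-- d = Σ_{j<i} t_j − Σ_{j<i} h_j ; remaining r's, s's, t's, and signs.

changed : Maybe Bool → Bool → Bool
changed (just true)  false = true
changed (just false) true  = true
changed _            _     = false

coeffGo : Maybe Bool → ℤ → List ℕ → List ℕ → List ℕ → List Bool → ℕ
coeffGo prev d rs       ss       []       []          = 1
coeffGo prev d (r ∷ rs) ss       (t ∷ ts) (true ∷ e)  =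
  ci *ℕ coeffGo (just true) d′ rs ss ts e
  where
  d′ = d ℤ.+ (+ t) ℤ.- (+ r)
  ci : ℕ
  ci = if changed prev true then binomℤ (t ∸ 1) d′ else (t ∸ 1) C (r ∸ 1)
coeffGo prev d rs       (s ∷ ss) (t ∷ ts) (false ∷ e) =
  ci *ℕ coeffGo (just false) d′ rs ss ts e
  where
  d′ = d ℤ.+ (+ t) ℤ.- (+ s)
  ci : ℕ
  ci = if changed prev false then binomℤ (t ∸ 1) d′ else (t ∸ 1) C (s ∸ 1)
coeffGo _ _ _ _ _ _ = 0   -- length mismatch; never reached

coeff : List ℕ → List ℕ → List ℕ → List Bool → ℕ
coeff r s t e = coeffGo nothing (+ 0) r s t e

module WithGroup {c ℓ : Level} (G : AbelianGroup c ℓ) where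
  open AbelianGroup G renaming (Carrier to A)

  -- words in ℤ≥1 × G : (s₁,b₁)…(s_k,b_k)  (entries s stored as ℕ, ≥ 1)
  BWord : Set c
  BWord = List (ℕ × A)

  mkWord : List ℕ → List A → BWord
  mkWord []       _        = []
  mkWord (_ ∷ _)  []       = []
  mkWord (t ∷ ts) (g ∷ gs) = (t , g) ∷ mkWord ts gs

  _≈W_ : BWord → BWord → Set (c ⊔ ℓ)
  _≈W_ = Pointwise (λ p q → (Data.Product.proj₁ p ≡ Data.Product.proj₁ q)
                           × (Data.Product.proj₂ p ≈ Data.Product.proj₂ q))

  -- H(ℤ≥1 × G): formal ℤ-linear combinations of words
  FSum : Set c
  FSum = List (ℤ × BWord)

  eval : (BWord → ℤ) → FSum → ℤ
  eval f []             = + 0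
  eval f ((n , u) ∷ xs) = n ℤ.* f u ℤ.+ eval f xs

  -- equality in the free abelian group on words (words identified up to ≈W):
  -- every ℤ-valued function on words respecting ≈W has the same linear
  -- extension on both sides.
  _≋_ : FSum → FSum → Set (c ⊔ ℓ)
  xs ≋ ys = (f : BWord → ℤ) → (∀ u v → u ≈W v → f u ≡ f v) → eval f xs ≡ eval f ys

  data Letter : Set c where
    x₀ : Letter
    x  : A → Letter

  shuffle : List Letter → List Letter → List (List Letter)
  shuffle []       v        = v ∷ []
  shuffle (a ∷ u)  []       = (a ∷ u) ∷ []
  shuffle (a ∷ u)  (b ∷ v)  =
    map (a ∷_) (shuffle u (b ∷ v)) ++ map (b ∷_) (shuffle (a ∷ u) v)

  _/_ : A → A → A
  a / b = a ∙ b ⁻¹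

  -- η : x₀^{s₁-1} x_{b₁} ⋯ x₀^{s_k-1} x_{b_k} ↦ (s₁,…,s_k ; 1/b₁, b₁/b₂, …, b_{k-1}/b_k)
  -- state: previous b (initially 1 = ε) and number of x₀'s read so far.
  -- (trailing x₀'s are dropped: such words are not in H₁ and never occur.)
  ηGo : A → ℕ → List Letter → BWord
  ηGo prev n []          = []
  ηGo prev n (x₀ ∷ u)    = ηGo prev (suc n) u
  ηGo prev n (x b ∷ u)   = (suc n , prev / b) ∷ ηGo b 0 u

  η : List Letter → BWord
  η = ηGo ε 0

  -- η⁻¹ : (s₁,…,s_k ; b₁,…,b_k) ↦ x₀^{s₁-1} x_{a₁} ⋯ x₀^{s_k-1} x_{a_k}
  -- with a_i = (b₁⋯b_i)⁻¹  (so that 1/a₁ = b₁, a_{i-1}/a_i = b_i).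
  -- state: p = b₁⋯b_{i-1}.
  η⁻¹Go : A → BWord → List Letter
  η⁻¹Go p []             = []
  η⁻¹Go p ((s , b) ∷ u)  = replicate (s ∸ 1) x₀ ++ (x ((p ∙ b) ⁻¹) ∷ η⁻¹Go (p ∙ b) u)

  η⁻¹ : BWord → List Letter
  η⁻¹ = η⁻¹Go ε

  _⧢η_ : BWord → BWord → FSum
  u ⧢η v = map (λ W → (+ 1 , η W)) (shuffle (η⁻¹ u) (η⁻¹ v))

  -- w \overline{⧢}_{(φ,ψ)} z.  State: ε(i-1) (nothing for i = 1),
  -- Pw = w₁⋯w_{j-1} (product of w's used), Pz = product of z's used.
  barGo : Maybe Bool → A → A → List A → List A → List Bool → List A
  barGo prev Pw Pz (w ∷ ws) zs (true ∷ e) = entry ∷ barGo (just true) (Pw ∙ w) Pz ws zs e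
    where
    entry : A
    entry = if changed prev true then (Pw ∙ w) / Pz else w
  barGo prev Pw Pz ws (z ∷ zs) (false ∷ e) = entry ∷ barGo (just false) Pw (Pz ∙ z) ws zs e
    where
    entry : A
    entry = if changed prev false then (Pz ∙ z) / Pw else z
  barGo _ _ _ _ _ _ = []

  bar : List A → List A → List Bool → List A
  bar w z e = barGo nothing ε ε w z e

  rhs : (k l : ℕ) → List ℕ → List A → List ℕ → List A → FSum
  rhs k l r w s z =
    concatMap (λ e →
      map (λ t → (+ coeff r s t e , mkWord t (bar w z e)))
          (compositions (k Data.Nat.+ l) (sum r Data.Nat.+ sum s)))
      (interleavings k l)

{-# OPTIONS --safe #-}
module Submission where

-- Compare both sides against an arbitrary test function f on words.  The letter word η⁻¹(r ; w)
-- is a sequence of blocks x₀^(rᵢ−1) x_aᵢ with aᵢ = (w₁⋯wᵢ)⁻¹, and a shuffle of two such words is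
-- built block by block: its first x-letter comes from one word, preceded by the x₀'s of that block
-- and by some m x₀'s of the other word's current block, in a binomial number of ways.  Under η the
-- prefix becomes one entry t, labelled wⱼ if the previous x-letter came from the same word and by a
-- quotient of prefix products after a switch.  So the shuffle after a prefix is described by the side
-- of the last letter, the products of the consumed labels and the number d of x₀'s already taken
-- from the other word: precisely the running state of coeffGo and barGo, with d = Σ t − Σ h.  Both
-- sides thus obey the same recursion, the binomial coefficients vanishing exactly for the
-- compositions t that ask for more x₀'s than are available.

open import Defs
open import Level using (Level)
open import Algebra.Bundles using (AbelianGroup)
open import Data.Nat using (ℕ; _≤_)
open import Data.Vec using (Vec; toList)
open import Data.Vec.Relation.Unary.All using (All)

open import Data.Vec using ([]; _∷_)
open import Data.Vec.Relation.Unary.All using ([]; _∷_)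
open import Function using (_∘_; id)
open import Data.Nat as ℕ using (zero; suc; _<_; z≤n; s≤s; _∸_)
import Data.Nat.Properties as ℕP
open import Data.Nat.Combinatorics using (_C_; nCn≡1; k>n⇒nCk≡0; nCk≡nC[n∸k]; nCk+nC[k+1]≡[n+1]C[k+1])
open import Data.Nat.ListAction using (sum)
open import Data.Nat.Tactic.RingSolver using (solve-∀)
open import Data.Integer using (ℤ; +_; _+_; _*_; _-_; _⊖_)
import Data.Integer.Properties as ℤP
open import Algebra.Properties.CommutativeSemigroup ℤP.+-commutativeSemigroup using () renaming (interchange to +-interchange)
open import Data.List using (List; []; _∷_; _++_; map; concat; concatMap; applyUpTo; upTo; replicate)
open import Data.Product using (_×_; _,_)
open import Data.Bool using (Bool; true; false; if_then_else_)
open import Data.Maybe using (Maybe; just; nothing)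
open import Relation.Binary.PropositionalEquality
open import Relation.Nullary using (yes; no)
open import Data.Empty using (⊥-elim)
import Data.List.Relation.Binary.Pointwise as Pointwise

-- Finite sums in ℤ

private variable
  ℓx : Level
  S T : Set ℓx

sumList : List S → (S → ℤ) → ℤ
sumList []       g = + 0
sumList (x ∷ xs) g = g x + sumList xs g

sumUpTo : (ℕ → ℤ) → ℕ → ℤ
sumUpTo g zero    = + 0
sumUpTo g (suc n) = g 0 + sumUpTo (g ∘ suc) n

sumList-++ : (xs ys : List S) (g : S → ℤ) → sumList (xs ++ ys) g ≡ sumList xs g + sumList ys g
sumList-++ []       ys g = sym (ℤP.+-identityˡ _)
sumList-++ (x ∷ xs) ys g = trans (cong (λ u → g x + u) (sumList-++ xs ys g)) (sym (ℤP.+-assoc (g x) _ _))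

sumList-cong : (xs : List S) {g h : S → ℤ} → (∀ x → g x ≡ h x) → sumList xs g ≡ sumList xs h
sumList-cong []       e = refl
sumList-cong (x ∷ xs) e = cong₂ _+_ (e x) (sumList-cong xs e)

sumList-*ˡ : (xs : List S) (c : ℤ) (g : S → ℤ) → sumList xs (λ x → c * g x) ≡ c * sumList xs g
sumList-*ˡ []       c g = sym (ℤP.*-zeroʳ c)
sumList-*ˡ (x ∷ xs) c g =
  trans (cong (λ u → c * g x + u) (sumList-*ˡ xs c g)) (sym (ℤP.*-distribˡ-+ c (g x) _))

sumList-map : (h : S → T) (xs : List S) (g : T → ℤ) → sumList (map h xs) g ≡ sumList xs (g ∘ h)
sumList-map h []       g = refl
sumList-map h (x ∷ xs) g = cong (λ u → g (h x) + u) (sumList-map h xs g)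

sumList-concatMap : (h : S → List T) (xs : List S) (g : T → ℤ) →
  sumList (concatMap h xs) g ≡ sumList xs (λ x → sumList (h x) g)
sumList-concatMap h []       g = refl
sumList-concatMap h (x ∷ xs) g =
  trans (sumList-++ (h x) (concat (map h xs)) g) (cong (λ u → sumList (h x) g + u) (sumList-concatMap h xs g))

sumList-applyUpTo : (h : ℕ → T) (n : ℕ) (g : T → ℤ) → sumList (applyUpTo h n) g ≡ sumUpTo (g ∘ h) n
sumList-applyUpTo h zero    g = refl
sumList-applyUpTo h (suc n) g = cong (λ u → g (h 0) + u) (sumList-applyUpTo (h ∘ suc) n g)

sumUpTo-cong : (n : ℕ) {g h : ℕ → ℤ} → (∀ m → m < n → g m ≡ h m) → sumUpTo g n ≡ sumUpTo h n
sumUpTo-cong zero    e = refl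
sumUpTo-cong (suc n) e = cong₂ _+_ (e 0 (s≤s z≤n)) (sumUpTo-cong n (λ m m<n → e (suc m) (s≤s m<n)))

sumUpTo-zero : (n : ℕ) (g : ℕ → ℤ) → (∀ m → m < n → g m ≡ + 0) → sumUpTo g n ≡ + 0
sumUpTo-zero n g e = trans (sumUpTo-cong n e) (zeros n)
  where
  zeros : ∀ n → sumUpTo (λ _ → + 0) n ≡ + 0
  zeros zero    = refl
  zeros (suc n) = trans (ℤP.+-identityˡ _) (zeros n)

sumUpTo-+ : (n : ℕ) (g h : ℕ → ℤ) → sumUpTo (λ m → g m + h m) n ≡ sumUpTo g n + sumUpTo h n
sumUpTo-+ zero    g h = refl
sumUpTo-+ (suc n) g h =
  trans (cong (λ u → g 0 + h 0 + u) (sumUpTo-+ n (g ∘ suc) (h ∘ suc))) (+-interchange (g 0) (h 0) _ _)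

sumUpTo-+-split : (m n : ℕ) (g : ℕ → ℤ) → sumUpTo g (m ℕ.+ n) ≡ sumUpTo g m + sumUpTo (λ i → g (m ℕ.+ i)) n
sumUpTo-+-split zero    n g = sym (ℤP.+-identityˡ _)
sumUpTo-+-split (suc m) n g =
  trans (cong (λ u → g 0 + u) (sumUpTo-+-split m n (g ∘ suc))) (sym (ℤP.+-assoc (g 0) _ _))

sumList-sumUpTo : (xs : List S) (n : ℕ) (g : S → ℕ → ℤ) →
  sumList xs (λ x → sumUpTo (g x) n) ≡ sumUpTo (λ m → sumList xs (λ x → g x m)) n
sumList-sumUpTo []       n g = sym (sumUpTo-zero n _ (λ _ _ → refl))
sumList-sumUpTo (x ∷ xs) n g =
  trans (cong (λ u → sumUpTo (g x) n + u) (sumList-sumUpTo xs n g))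
        (sym (sumUpTo-+ n (g x) (λ m → sumList xs (λ x → g x m))))

sumUpTo-window : (g : ℕ → ℤ) (A B N : ℕ) → A ℕ.+ B < N →
  (∀ a → a < A → g a ≡ + 0) → (∀ a → A ℕ.+ B < a → a < N → g a ≡ + 0) →
  sumUpTo g N ≡ sumUpTo (λ m → g (A ℕ.+ m)) (suc B)
sumUpTo-window g A B N A+B<N below above = begin
  sumUpTo g N
    ≡⟨ cong (sumUpTo g) (sym A+[1+B+R]≡N) ⟩
  sumUpTo g (A ℕ.+ (suc B ℕ.+ R))
    ≡⟨ sumUpTo-+-split A _ g ⟩
  sumUpTo g A + sumUpTo gA (suc B ℕ.+ R)
    ≡⟨ cong₂ _+_ (sumUpTo-zero A g below) (sumUpTo-+-split (suc B) R gA) ⟩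
  + 0 + (sumUpTo gA (suc B) + sumUpTo (λ m → gA (suc B ℕ.+ m)) R)
    ≡⟨ ℤP.+-identityˡ _ ⟩
  sumUpTo gA (suc B) + sumUpTo (λ m → gA (suc B ℕ.+ m)) R
    ≡⟨ cong (λ u → sumUpTo gA (suc B) + u) (sumUpTo-zero R _ beyond) ⟩
  sumUpTo gA (suc B) + + 0
    ≡⟨ ℤP.+-identityʳ _ ⟩
  sumUpTo gA (suc B) ∎
  where
  open ≡-Reasoning
  gA : ℕ → ℤ
  gA m = g (A ℕ.+ m)
  R : ℕ
  R = N ∸ (A ℕ.+ suc B)
  A+[1+B+R]≡N : A ℕ.+ (suc B ℕ.+ R) ≡ N
  A+[1+B+R]≡N = trans (sym (ℕP.+-assoc A (suc B) R))
                      (ℕP.m+[n∸m]≡n (ℕP.≤-trans (ℕP.≤-reflexive (ℕP.+-suc A B)) A+B<N))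
  beyond : ∀ m → m < R → gA (suc B ℕ.+ m) ≡ + 0
  beyond m m<R = above _
    (ℕP.≤-trans (ℕP.≤-reflexive (sym (ℕP.+-suc A B))) (ℕP.+-monoʳ-≤ A (s≤s (ℕP.m≤m+n B m))))
    (subst (A ℕ.+ (suc B ℕ.+ m) <_) A+[1+B+R]≡N (ℕP.+-monoʳ-< A (ℕP.+-monoʳ-< (suc B) m<R)))

[a+0]Ca≡1 : ∀ a → (a ℕ.+ 0) C a ≡ 1
[a+0]Ca≡1 a = trans (cong (_C a) (ℕP.+-identityʳ a)) (nCn≡1 a)

sumUpTo-pascal : ∀ a n (X : ℕ → ℤ) →
  sumUpTo (λ m → + ((a ℕ.+ m) C a) * X m) (suc n) + sumUpTo (λ m → + ((suc a ℕ.+ m) C suc a) * X (suc m)) n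
  ≡ sumUpTo (λ m → + ((suc a ℕ.+ m) C suc a) * X m) (suc n)
sumUpTo-pascal a n X = begin
  + ((a ℕ.+ 0) C a) * X 0 + Sa + Sa′
    ≡⟨ ℤP.+-assoc (+ ((a ℕ.+ 0) C a) * X 0) Sa Sa′ ⟩
  + ((a ℕ.+ 0) C a) * X 0 + (Sa + Sa′)
    ≡⟨ cong₂ (λ u v → + u * X 0 + v) (trans ([a+0]Ca≡1 a) (sym ([a+0]Ca≡1 (suc a)))) merge ⟩
  + ((suc a ℕ.+ 0) C suc a) * X 0 + sumUpTo (λ m → + ((suc a ℕ.+ suc m) C suc a) * X (suc m)) n ∎
  where
  open ≡-Reasoning
  Sa Sa′ : ℤ
  Sa  = sumUpTo (λ m → + ((a ℕ.+ suc m) C a) * X (suc m)) n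
  Sa′ = sumUpTo (λ m → + ((suc a ℕ.+ m) C suc a) * X (suc m)) n
  pascal : ∀ m → (a ℕ.+ suc m) C a ℕ.+ (suc a ℕ.+ m) C suc a ≡ (suc a ℕ.+ suc m) C suc a
  pascal m = begin
    (a ℕ.+ suc m) C a ℕ.+ (suc a ℕ.+ m) C suc a ≡⟨ cong (λ k → k C a ℕ.+ (suc a ℕ.+ m) C suc a) (ℕP.+-suc a m) ⟩
    suc (a ℕ.+ m) C a ℕ.+ suc (a ℕ.+ m) C suc a ≡⟨ nCk+nC[k+1]≡[n+1]C[k+1] (suc (a ℕ.+ m)) a ⟩
    suc (suc (a ℕ.+ m)) C suc a                 ≡⟨ cong (λ k → suc k C suc a) (sym (ℕP.+-suc a m)) ⟩
    (suc a ℕ.+ suc m) C suc a                   ∎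
  merge : Sa + Sa′ ≡ sumUpTo (λ m → + ((suc a ℕ.+ suc m) C suc a) * X (suc m)) n
  merge = trans (sym (sumUpTo-+ n _ _)) (sumUpTo-cong n λ m _ →
    trans (sym (ℤP.*-distribʳ-+ (X (suc m)) (+ ((a ℕ.+ suc m) C a)) (+ ((suc a ℕ.+ m) C suc a))))
          (cong (_* X (suc m)) (cong +_ (pascal m))))

sumList-compositions-suc : ∀ n N (H : List ℕ → ℤ) →
  sumList (compositions (suc n) N) H ≡ sumUpTo (λ a → sumList (compositions n (N ∸ suc a)) (H ∘ (suc a ∷_))) N
sumList-compositions-suc n N H = begin
  sumList (compositions (suc n) N) H
    ≡⟨ sumList-concatMap (λ a → map (suc a ∷_) (compositions n (N ∸ suc a))) (upTo N) H ⟩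
  sumList (upTo N) (λ a → sumList (map (suc a ∷_) (compositions n (N ∸ suc a))) H)
    ≡⟨ sumList-applyUpTo id N _ ⟩
  sumUpTo (λ a → sumList (map (suc a ∷_) (compositions n (N ∸ suc a))) H) N
    ≡⟨ sumUpTo-cong N (λ a _ → sumList-map (suc a ∷_) (compositions n (N ∸ suc a)) H) ⟩
  sumUpTo (λ a → sumList (compositions n (N ∸ suc a)) (H ∘ (suc a ∷_))) N ∎
  where open ≡-Reasoning

-- The deficit d = Σ t − Σ h of coeffGo

deficitAfter : ℤ → ℕ → ℕ → ℤ
deficitAfter d t h = d + + t - + h

deficitAfter-≡ : ∀ d t h e → h ℕ.+ e ≡ d ℕ.+ t → deficitAfter (+ d) t h ≡ + e
deficitAfter-≡ d t h e eq = begin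
  + (d ℕ.+ t) - + h   ≡⟨ ℤP.[+m]-[+n]≡m⊖n (d ℕ.+ t) h ⟩
  (d ℕ.+ t) ⊖ h       ≡⟨ cong (_⊖ h) (sym eq) ⟩
  (h ℕ.+ e) ⊖ h       ≡⟨ ℤP.⊖-≥ (ℕP.m≤m+n h e) ⟩
  + (h ℕ.+ e ∸ h)     ≡⟨ cong +_ (ℕP.m+n∸m≡n h e) ⟩
  + e                 ∎
  where open ≡-Reasoning

binomℤ-deficitAfter-< : ∀ b d t h → d ℕ.+ t < h → binomℤ b (deficitAfter (+ d) t h) ≡ 0
binomℤ-deficitAfter-< b d t h lt
  rewrite ℤP.[+m]-[+n]≡m⊖n (d ℕ.+ t) h | ℤP.⊖-< lt
  with h ∸ (d ℕ.+ t) | ℕP.m>n⇒m∸n≢0 lt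
... | zero  | ≢0 = ⊥-elim (≢0 refl)
... | suc _ | _  = refl

binomℤ-+ : ∀ b m → binomℤ (b ℕ.+ m) (+ m) ≡ (b ℕ.+ m) C b
binomℤ-+ b m = trans (nCk≡nC[n∸k] (ℕP.m≤n+m m b)) (cong ((b ℕ.+ m) C_) (ℕP.m+n∸n≡m b m))

∸-balance : ∀ {N d R} t h e → t ≤ N → h ℕ.+ e ≡ d ℕ.+ t → N ℕ.+ d ≡ h ℕ.+ R → (N ∸ t) ℕ.+ e ≡ R
∸-balance {N} {d} {R} t h e t≤N step eq = ℕP.+-cancelˡ-≡ h _ _ (begin
  h ℕ.+ ((N ∸ t) ℕ.+ e) ≡⟨ exchange h (N ∸ t) e ⟩
  (N ∸ t) ℕ.+ (h ℕ.+ e) ≡⟨ cong ((N ∸ t) ℕ.+_) step ⟩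
  (N ∸ t) ℕ.+ (d ℕ.+ t) ≡⟨ rotate (N ∸ t) d t ⟩
  ((N ∸ t) ℕ.+ t) ℕ.+ d ≡⟨ cong (ℕ._+ d) (ℕP.m∸n+n≡m t≤N) ⟩
  N ℕ.+ d               ≡⟨ eq ⟩
  h ℕ.+ R               ∎)
  where
  open ≡-Reasoning
  exchange : ∀ a b c → a ℕ.+ (b ℕ.+ c) ≡ b ℕ.+ (a ℕ.+ c)
  exchange = solve-∀
  rotate : ∀ a b c → a ℕ.+ (b ℕ.+ c) ≡ (a ℕ.+ c) ℕ.+ b
  rotate = solve-∀

overdrawn-≡ : ∀ d t h g → h ℕ.+ g < d ℕ.+ t → h ℕ.+ (d ℕ.+ t ∸ h) ≡ d ℕ.+ t
overdrawn-≡ d t h g lt = ℕP.m+[n∸m]≡n (ℕP.≤-trans (ℕP.m≤m+n h g) (ℕP.<⇒≤ lt))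

overdrawn-< : ∀ d t h g → h ℕ.+ g < d ℕ.+ t → g < d ℕ.+ t ∸ h
overdrawn-< d t h g lt = ℕP.m+n≤o⇒m≤o∸n (suc g) (subst (_≤ d ℕ.+ t) (cong suc (ℕP.+-comm h g)) lt)

<-from-+≤ : ∀ {x N} d h R → x ℕ.+ d ≤ h ℕ.+ R → N ℕ.+ d ≡ suc h ℕ.+ R → x < N
<-from-+≤ {x} {N} d h R le eq = ℕP.+-cancelʳ-< d x N (subst (x ℕ.+ d <_) (sym eq) (s≤s le))

entrySum : ∀ {k} → Vec ℕ k → ℕ
entrySum r = sum (toList r)

leadingX₀ : ∀ {k} → Vec ℕ k → ℕ
leadingX₀ []      = 0
leadingX₀ (r ∷ _) = r ∸ 1

leadingX₀≤entrySum : ∀ {k} (r : Vec ℕ k) → leadingX₀ r ≤ entrySum r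
leadingX₀≤entrySum []      = z≤n
leadingX₀≤entrySum (r ∷ rs) = ℕP.≤-trans (ℕP.m∸n≤m r 1) (ℕP.m≤m+n r (entrySum rs))


module ShuffleExpansion {c ℓ : Level} (G : AbelianGroup c ℓ) where

  open AbelianGroup G using (_∙_; _⁻¹; ε; _≈_; ∙-congʳ) renaming (Carrier to A)
  module ≈ = AbelianGroup G using (refl; sym; trans)
  open import Algebra.Properties.AbelianGroup G using (ε⁻¹≈ε; ⁻¹-∙-comm; ⁻¹-anti-homo‿-; xyx⁻¹≈y)
  open WithGroup G

  private variable
    k l : ℕ

  inv-/-inv : ∀ P Q → (P ⁻¹) / (Q ⁻¹) ≈ Q / P
  inv-/-inv P Q = ≈.trans (⁻¹-∙-comm P (Q ⁻¹)) (⁻¹-anti-homo‿- P Q)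

  inv-/-inv-∙ : ∀ P w → (P ⁻¹) / ((P ∙ w) ⁻¹) ≈ w
  inv-/-inv-∙ P w = ≈.trans (inv-/-inv P (P ∙ w)) (xyx⁻¹≈y P w)

  ε-/-inv-∙ : ∀ w → ε / ((ε ∙ w) ⁻¹) ≈ w
  ε-/-inv-∙ w = ≈.trans (∙-congʳ (≈.sym ε⁻¹≈ε)) (inv-/-inv-∙ ε w)

  Respects : (BWord → ℤ) → Set (c Level.⊔ ℓ)
  Respects f = ∀ u v → u ≈W v → f u ≡ f v

  respects-∷ : ∀ {f} p → Respects f → Respects (f ∘ (p ∷_))
  respects-∷ p resp u v u≈v = resp _ _ ((refl , ≈.refl) Pointwise.∷ u≈v)

  x₀^_ : ℕ → List Letter
  x₀^ n = replicate n x₀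

  ηGo-block : ∀ γ n p α W → ηGo γ n (x₀^ p ++ x α ∷ W) ≡ (suc (p ℕ.+ n) , γ / α) ∷ ηGo α 0 W
  ηGo-block γ n zero    α W = refl
  ηGo-block γ n (suc p) α W =
    trans (ηGo-block γ (suc n) p α W) (cong (λ q → (suc q , γ / α) ∷ ηGo α 0 W) (ℕP.+-suc p n))

  respects-block : ∀ {f} → Respects f → ∀ {γ α lab} → γ / α ≈ lab →
    ∀ p W → f (ηGo γ 0 (x₀^ p ++ x α ∷ W)) ≡ f ((suc p , lab) ∷ ηGo α 0 W)
  respects-block {f} resp {γ} {α} {lab} γ/α≈lab p W = begin
    f (ηGo γ 0 (x₀^ p ++ x α ∷ W))           ≡⟨ cong f (ηGo-block γ 0 p α W) ⟩
    f ((suc (p ℕ.+ 0) , γ / α) ∷ ηGo α 0 W)  ≡⟨ cong (λ q → f ((suc q , γ / α) ∷ ηGo α 0 W)) (ℕP.+-identityʳ p) ⟩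
    f ((suc p , γ / α) ∷ ηGo α 0 W)          ≡⟨ resp _ _ ((refl , γ/α≈lab) Pointwise.∷ Pointwise.refl (refl , ≈.refl)) ⟩
    f ((suc p , lab) ∷ ηGo α 0 W)            ∎
    where open ≡-Reasoning

  lettersOf : A → Vec ℕ k → Vec A k → List Letter
  lettersOf P r w = η⁻¹Go P (mkWord (toList r) (toList w))

  lettersOf-dropX₀ : ℕ → A → Vec ℕ k → Vec A k → List Letter
  lettersOf-dropX₀ d P []       []       = []
  lettersOf-dropX₀ d P (r₁ ∷ r) (w₁ ∷ w) = x₀^ (r₁ ∸ 1 ∸ d) ++ x ((P ∙ w₁) ⁻¹) ∷ lettersOf (P ∙ w₁) r w

  sumList-shuffle-∷ : ∀ p q P Q (F : List Letter → ℤ) →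
    sumList (shuffle (p ∷ P) (q ∷ Q)) F
    ≡ sumList (shuffle P (q ∷ Q)) (F ∘ (p ∷_)) + sumList (shuffle (p ∷ P) Q) (F ∘ (q ∷_))
  sumList-shuffle-∷ p q P Q F =
    trans (sumList-++ (map (p ∷_) (shuffle P (q ∷ Q))) (map (q ∷_) (shuffle (p ∷ P) Q)) F)
          (cong₂ _+_ (sumList-map (p ∷_) (shuffle P (q ∷ Q)) F) (sumList-map (q ∷_) (shuffle (p ∷ P) Q) F))

  -- In (x₀^a x_α U) ⧢ (x₀^b x_β V) a term is determined by which of x_α, x_β comes first, say x_α,
  -- and by the number m of x₀'s of the second block placed before it; there are C(a+m, a) such terms.
  module FirstBlocks (α β : A) (U V : List Letter) where

    αFirst : ℕ → ℕ → (List Letter → ℤ) → ℕ → ℤ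
    αFirst a b F m = sumList (shuffle U (x₀^ (b ∸ m) ++ x β ∷ V)) (λ W → F (x₀^ (a ℕ.+ m) ++ x α ∷ W))

    βFirst : ℕ → ℕ → (List Letter → ℤ) → ℕ → ℤ
    βFirst a b F m = sumList (shuffle (x₀^ (a ∸ m) ++ x α ∷ U) V) (λ W → F (x₀^ (b ℕ.+ m) ++ x β ∷ W))

    expansion : ℕ → ℕ → (List Letter → ℤ) → ℤ
    expansion a b F = sumUpTo (λ m → + ((a ℕ.+ m) C a) * αFirst a b F m) (suc b)
                    + sumUpTo (λ m → + ((b ℕ.+ m) C b) * βFirst a b F m) (suc a)

    private
      single : ∀ y → y ≡ + 1 * y + + 0
      single y = sym (trans (ℤP.+-identityʳ _) (ℤP.*-identityˡ y))

    sumList-shuffle-blocks : ∀ a b F → sumList (shuffle (x₀^ a ++ x α ∷ U) (x₀^ b ++ x β ∷ V)) F ≡ expansion a b F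
    sumList-shuffle-blocks zero zero F =
      trans (sumList-shuffle-∷ (x α) (x β) U V F) (cong₂ _+_ (single (αFirst 0 0 F 0)) (single (βFirst 0 0 F 0)))
    sumList-shuffle-blocks (suc a) zero F = begin
      sumList (shuffle (x₀^ suc a ++ x α ∷ U) (x β ∷ V)) F
        ≡⟨ sumList-shuffle-∷ x₀ (x β) (x₀^ a ++ x α ∷ U) V F ⟩
      sumList (shuffle (x₀^ a ++ x α ∷ U) (x β ∷ V)) (F ∘ (x₀ ∷_)) + Yβ
        ≡⟨ cong (_+ Yβ) (sumList-shuffle-blocks a zero (F ∘ (x₀ ∷_))) ⟩
      (Xα + Y) + Yβ
        ≡⟨ ℤP.+-assoc Xα Y Yβ ⟩
      Xα + (Y + Yβ)
        ≡⟨ cong₂ _+_ (cong (λ u → u * αFirst a zero (F ∘ (x₀ ∷_)) 0 + + 0) (cong +_ (trans ([a+0]Ca≡1 a) (sym ([a+0]Ca≡1 (suc a))))))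
                     (trans (ℤP.+-comm Y Yβ) (cong (_+ Y) (sym (ℤP.*-identityˡ Yβ)))) ⟩
      expansion (suc a) zero F ∎
      where
      open ≡-Reasoning
      Yβ Xα Y : ℤ
      Yβ = sumList (shuffle (x₀^ suc a ++ x α ∷ U) V) (F ∘ (x β ∷_))
      Xα = sumUpTo (λ m → + ((a ℕ.+ m) C a) * αFirst a zero (F ∘ (x₀ ∷_)) m) 1
      Y  = sumUpTo (λ m → + ((zero ℕ.+ m) C zero) * βFirst a zero (F ∘ (x₀ ∷_)) m) (suc a)
    sumList-shuffle-blocks zero (suc b) F = begin
      sumList (shuffle (x α ∷ U) (x₀^ suc b ++ x β ∷ V)) F
        ≡⟨ sumList-shuffle-∷ (x α) x₀ U (x₀^ b ++ x β ∷ V) F ⟩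
      Xα + sumList (shuffle (x α ∷ U) (x₀^ b ++ x β ∷ V)) (F ∘ (x₀ ∷_))
        ≡⟨ cong (λ u → Xα + u) (sumList-shuffle-blocks zero b (F ∘ (x₀ ∷_))) ⟩
      Xα + (X + Yβ)
        ≡⟨ sym (ℤP.+-assoc Xα X Yβ) ⟩
      Xα + X + Yβ
        ≡⟨ cong₂ _+_ (cong (_+ X) (sym (ℤP.*-identityˡ Xα)))
                     (cong (λ u → u * βFirst zero b (F ∘ (x₀ ∷_)) 0 + + 0) (cong +_ (trans ([a+0]Ca≡1 b) (sym ([a+0]Ca≡1 (suc b)))))) ⟩
      expansion zero (suc b) F ∎
      where
      open ≡-Reasoning
      Xα X Yβ : ℤ
      Xα = sumList (shuffle U (x₀^ suc b ++ x β ∷ V)) (F ∘ (x α ∷_))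
      X  = sumUpTo (λ m → + ((zero ℕ.+ m) C zero) * αFirst zero b (F ∘ (x₀ ∷_)) m) (suc b)
      Yβ = sumUpTo (λ m → + ((b ℕ.+ m) C b) * βFirst zero b (F ∘ (x₀ ∷_)) m) 1
    sumList-shuffle-blocks (suc a) (suc b) F = begin
      sumList (shuffle (x₀^ suc a ++ x α ∷ U) (x₀^ suc b ++ x β ∷ V)) F
        ≡⟨ sumList-shuffle-∷ x₀ x₀ (x₀^ a ++ x α ∷ U) (x₀^ b ++ x β ∷ V) F ⟩
      sumList (shuffle (x₀^ a ++ x α ∷ U) (x₀^ suc b ++ x β ∷ V)) F₀
        + sumList (shuffle (x₀^ suc a ++ x α ∷ U) (x₀^ b ++ x β ∷ V)) F₀
        ≡⟨ cong₂ _+_ (sumList-shuffle-blocks a (suc b) F₀) (sumList-shuffle-blocks (suc a) b F₀) ⟩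
      (X₁ + Y₁) + (X₂ + Y₂)
        ≡⟨ +-interchange X₁ Y₁ X₂ Y₂ ⟩
      (X₁ + X₂) + (Y₁ + Y₂)
        ≡⟨ cong₂ _+_ (trans (cong (λ u → X₁ + u) X₂≡) (sumUpTo-pascal a (suc b) X))
                     (trans (ℤP.+-comm Y₁ Y₂) (trans (cong (λ u → Y₂ + u) Y₁≡) (sumUpTo-pascal b (suc a) Y))) ⟩
      expansion (suc a) (suc b) F ∎
      where
      open ≡-Reasoning
      F₀ : List Letter → ℤ
      F₀ = F ∘ (x₀ ∷_)
      X Y : ℕ → ℤ
      X = αFirst (suc a) (suc b) F
      Y = βFirst (suc a) (suc b) F
      X₁ X₂ Y₁ Y₂ : ℤ
      X₁ = sumUpTo (λ m → + ((a ℕ.+ m) C a) * X m) (suc (suc b))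
      X₂ = sumUpTo (λ m → + ((suc a ℕ.+ m) C suc a) * αFirst (suc a) b F₀ m) (suc b)
      Y₁ = sumUpTo (λ m → + ((suc b ℕ.+ m) C suc b) * βFirst a (suc b) F₀ m) (suc a)
      Y₂ = sumUpTo (λ m → + ((b ℕ.+ m) C b) * Y m) (suc (suc a))
      X₂≡ : X₂ ≡ sumUpTo (λ m → + ((suc a ℕ.+ m) C suc a) * X (suc m)) (suc b)
      X₂≡ = sumUpTo-cong (suc b) λ m _ → cong (+ ((suc a ℕ.+ m) C suc a) *_)
        (sumList-cong (shuffle U (x₀^ (b ∸ m) ++ x β ∷ V))
          (λ W → cong (λ q → F (x₀ ∷ x₀^ q ++ x α ∷ W)) (sym (ℕP.+-suc a m))))
      Y₁≡ : Y₁ ≡ sumUpTo (λ m → + ((suc b ℕ.+ m) C suc b) * Y (suc m)) (suc a)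
      Y₁≡ = sumUpTo-cong (suc a) λ m _ → cong (+ ((suc b ℕ.+ m) C suc b) *_)
        (sumList-cong (shuffle (x₀^ (a ∸ m) ++ x α ∷ U) V)
          (λ W → cong (λ q → F (x₀ ∷ x₀^ q ++ x β ∷ W)) (sym (ℕP.+-suc b m))))

  shuffle-[]ʳ : ∀ U → shuffle U [] ≡ U ∷ []
  shuffle-[]ʳ []      = refl
  shuffle-[]ʳ (_ ∷ _) = refl

  sumList-shuffle-[]-block : ∀ b β V (F : List Letter → ℤ) →
    sumList (shuffle [] (x₀^ b ++ x β ∷ V)) F
    ≡ sumUpTo (λ m → + ((b ℕ.+ m) C b) * sumList (shuffle [] V) (λ W → F (x₀^ (b ℕ.+ m) ++ x β ∷ W))) 1
  sumList-shuffle-[]-block b β V F rewrite ℕP.+-identityʳ b | nCn≡1 b =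
    sym (trans (ℤP.+-identityʳ _) (ℤP.*-identityˡ _))

  sumList-shuffle-block-[] : ∀ a α U (F : List Letter → ℤ) →
    sumList (shuffle (x₀^ a ++ x α ∷ U) []) F
    ≡ sumUpTo (λ m → + ((a ℕ.+ m) C a) * sumList (shuffle U []) (λ W → F (x₀^ (a ℕ.+ m) ++ x α ∷ W))) 1
  sumList-shuffle-block-[] a α U F
    rewrite ℕP.+-identityʳ a | nCn≡1 a | shuffle-[]ʳ (x₀^ a ++ x α ∷ U) | shuffle-[]ʳ U =
    sym (trans (ℤP.+-identityʳ _) (ℤP.*-identityˡ _))

  -- The right-hand side resumed from the state (prev, d, Pw, Pz) that coeffGo and barGo reach
  -- after a prefix of the sign sequence.
  rhsFrom : (BWord → ℤ) → Maybe Bool → ℤ → A → A → Vec ℕ k → Vec A k → Vec ℕ l → Vec A l → ℕ → ℕ → ℤ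
  rhsFrom {k} {l} f prev d Pw Pz r w s z n N =
    sumList (interleavings k l) λ e → sumList (compositions n N) λ t →
      + coeffGo prev d (toList r) (toList s) t e * f (mkWord t (barGo prev Pw Pz (toList w) (toList z) e))

  leftCoeff rightCoeff : Maybe Bool → ℤ → ℕ → ℕ → ℕ
  leftCoeff prev d r₁ a =
    if changed prev true then binomℤ a (deficitAfter d (suc a) r₁) else a C (r₁ ∸ 1)
  rightCoeff prev d s₁ a =
    if changed prev false then binomℤ a (deficitAfter d (suc a) s₁) else a C (s₁ ∸ 1)

  leftLabel rightLabel : Maybe Bool → A → A → A → A
  leftLabel prev Pw Pz w₁ = if changed prev true then (Pw ∙ w₁) / Pz else w₁
  rightLabel prev Pw Pz z₁ = if changed prev false then (Pz ∙ z₁) / Pw else z₁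

  rhsFrom-leftFirst : (BWord → ℤ) → Maybe Bool → ℤ → A → A →
    ℕ → Vec ℕ k → A → Vec A k → Vec ℕ l → Vec A l → ℕ → ℕ → ℤ
  rhsFrom-leftFirst f prev d Pw Pz r₁ r w₁ w s z n N = sumUpTo (λ a →
    + leftCoeff prev d r₁ a * rhsFrom (f ∘ ((suc a , leftLabel prev Pw Pz w₁) ∷_))
                                     (just true) (deficitAfter d (suc a) r₁) (Pw ∙ w₁) Pz r w s z n (N ∸ suc a)) N

  rhsFrom-rightFirst : (BWord → ℤ) → Maybe Bool → ℤ → A → A →
    Vec ℕ k → Vec A k → ℕ → Vec ℕ l → A → Vec A l → ℕ → ℕ → ℤ
  rhsFrom-rightFirst f prev d Pw Pz r w s₁ s z₁ z n N = sumUpTo (λ a →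
    + rightCoeff prev d s₁ a * rhsFrom (f ∘ ((suc a , rightLabel prev Pw Pz z₁) ∷_))
                                      (just false) (deficitAfter d (suc a) s₁) Pw (Pz ∙ z₁) r w s z n (N ∸ suc a)) N

  private
    sumList-byHead : (I : List (List Bool)) (b : Bool) (n N : ℕ) (H : List Bool → List ℕ → ℤ)
      (c : ℕ → ℕ) (H′ : ℕ → List Bool → List ℕ → ℤ) → (∀ a e t → H (b ∷ e) (suc a ∷ t) ≡ + c a * H′ a e t) →
      sumList I (λ e → sumList (compositions (suc n) N) (H (b ∷ e)))
      ≡ sumUpTo (λ a → + c a * sumList I (λ e → sumList (compositions n (N ∸ suc a)) (H′ a e))) N
    sumList-byHead I b n N H c H′ factor = begin
      sumList I (λ e → sumList (compositions (suc n) N) (H (b ∷ e)))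
        ≡⟨ sumList-cong I (λ e → trans (sumList-compositions-suc n N (H (b ∷ e)))
             (sumUpTo-cong N λ a _ → trans (sumList-cong (compositions n (N ∸ suc a)) (factor a e))
                                           (sumList-*ˡ (compositions n (N ∸ suc a)) (+ c a) (H′ a e)))) ⟩
      sumList I (λ e → sumUpTo (λ a → + c a * sumList (compositions n (N ∸ suc a)) (H′ a e)) N)
        ≡⟨ sumList-sumUpTo I N _ ⟩
      sumUpTo (λ a → sumList I (λ e → + c a * sumList (compositions n (N ∸ suc a)) (H′ a e))) N
        ≡⟨ sumUpTo-cong N (λ a _ → sumList-*ˡ I (+ c a) _) ⟩
      sumUpTo (λ a → + c a * sumList I (λ e → sumList (compositions n (N ∸ suc a)) (H′ a e))) N ∎
      where open ≡-Reasoning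

    +*-assoc : ∀ p q (y : ℤ) → + (p ℕ.* q) * y ≡ + p * (+ q * y)
    +*-assoc p q y = trans (cong (_* y) (ℤP.pos-* p q)) (ℤP.*-assoc (+ p) (+ q) y)

    leftFirst-≡ : ∀ f prev d Pw Pz r₁ (r : Vec ℕ k) w₁ w (s : Vec ℕ l) z n N →
      sumList (interleavings k l) (λ e → sumList (compositions (suc n) N) λ t →
        + coeffGo prev d (r₁ ∷ toList r) (toList s) t (true ∷ e)
          * f (mkWord t (barGo prev Pw Pz (w₁ ∷ toList w) (toList z) (true ∷ e))))
      ≡ rhsFrom-leftFirst f prev d Pw Pz r₁ r w₁ w s z n N
    leftFirst-≡ {k} {l} f prev d Pw Pz r₁ r w₁ w s z n N =
      sumList-byHead (interleavings k l) true n N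
        (λ e t → + coeffGo prev d (r₁ ∷ toList r) (toList s) t e * f (mkWord t (barGo prev Pw Pz (w₁ ∷ toList w) (toList z) e)))
        (leftCoeff prev d r₁) _ (λ a e t → +*-assoc (leftCoeff prev d r₁ a) _ _)

    -- r is split because coeffGo and barGo reach their false-clauses only once
    -- the list of remaining r's is seen to be [] or a cons.
    rightFirst-≡ : ∀ f prev d Pw Pz (r : Vec ℕ k) w s₁ (s : Vec ℕ l) z₁ z n N →
      sumList (interleavings k l) (λ e → sumList (compositions (suc n) N) λ t →
        + coeffGo prev d (toList r) (s₁ ∷ toList s) t (false ∷ e)
          * f (mkWord t (barGo prev Pw Pz (toList w) (z₁ ∷ toList z) (false ∷ e))))
      ≡ rhsFrom-rightFirst f prev d Pw Pz r w s₁ s z₁ z n N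
    rightFirst-≡ {l = l} f prev d Pw Pz [] [] s₁ s z₁ z n N =
      sumList-byHead (interleavings 0 l) false n N
        (λ e t → + coeffGo prev d [] (s₁ ∷ toList s) t e * f (mkWord t (barGo prev Pw Pz [] (z₁ ∷ toList z) e)))
        (rightCoeff prev d s₁) _ (λ a e t → +*-assoc (rightCoeff prev d s₁ a) _ _)
    rightFirst-≡ {l = l} f prev d Pw Pz (r₁ ∷ r) (w₁ ∷ w) s₁ s z₁ z n N =
      sumList-byHead (interleavings (suc _) l) false n N
        (λ e t → + coeffGo prev d (r₁ ∷ toList r) (s₁ ∷ toList s) t e * f (mkWord t (barGo prev Pw Pz (w₁ ∷ toList w) (z₁ ∷ toList z) e)))
        (rightCoeff prev d s₁) _ (λ a e t → +*-assoc (rightCoeff prev d s₁ a) _ _)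

  rhsFrom-∷-∷ : ∀ f prev d Pw Pz r₁ (r : Vec ℕ k) w₁ w s₁ (s : Vec ℕ l) z₁ z n N →
    rhsFrom f prev d Pw Pz (r₁ ∷ r) (w₁ ∷ w) (s₁ ∷ s) (z₁ ∷ z) (suc n) N
    ≡ rhsFrom-leftFirst f prev d Pw Pz r₁ r w₁ w (s₁ ∷ s) (z₁ ∷ z) n N
      + rhsFrom-rightFirst f prev d Pw Pz (r₁ ∷ r) (w₁ ∷ w) s₁ s z₁ z n N
  rhsFrom-∷-∷ {k} {l} f prev d Pw Pz r₁ r w₁ w s₁ s z₁ z n N =
    trans (sumList-++ (map (true ∷_) (interleavings k (suc l))) (map (false ∷_) (interleavings (suc k) l)) _)
      (cong₂ _+_ (trans (sumList-map (true ∷_) (interleavings k (suc l)) _) (leftFirst-≡ f prev d Pw Pz r₁ r w₁ w (s₁ ∷ s) (z₁ ∷ z) n N))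
                 (trans (sumList-map (false ∷_) (interleavings (suc k) l) _) (rightFirst-≡ f prev d Pw Pz (r₁ ∷ r) (w₁ ∷ w) s₁ s z₁ z n N)))

  rhsFrom-[]-∷ : ∀ f prev d Pw Pz s₁ (s : Vec ℕ l) z₁ z n N →
    rhsFrom f prev d Pw Pz [] [] (s₁ ∷ s) (z₁ ∷ z) (suc n) N ≡ rhsFrom-rightFirst f prev d Pw Pz [] [] s₁ s z₁ z n N
  rhsFrom-[]-∷ {l} f prev d Pw Pz s₁ s z₁ z n N =
    trans (sumList-map (false ∷_) (interleavings 0 l) _) (rightFirst-≡ f prev d Pw Pz [] [] s₁ s z₁ z n N)

  rhsFrom-∷-[] : ∀ f prev d Pw Pz r₁ (r : Vec ℕ k) w₁ w n N →
    rhsFrom f prev d Pw Pz (r₁ ∷ r) (w₁ ∷ w) [] [] (suc n) N ≡ rhsFrom-leftFirst f prev d Pw Pz r₁ r w₁ w [] [] n N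
  rhsFrom-∷-[] {k} f prev d Pw Pz r₁ r w₁ w n N =
    trans (sumList-map (true ∷_) (interleavings k 0) _) (leftFirst-≡ f prev d Pw Pz r₁ r w₁ w [] [] n N)

  rhsFrom-[] : ∀ f prev d Pw Pz N → N ℕ.+ 0 ≡ 0 → f [] + + 0 ≡ rhsFrom f prev d Pw Pz [] [] [] [] 0 N
  rhsFrom-[] f prev d Pw Pz zero refl = cong (_+ + 0) (sym (trans (ℤP.+-identityʳ _) (ℤP.*-identityˡ (f []))))

  private
    +*-zeroˡ : ∀ {c} y → c ≡ 0 → + c * y ≡ + 0
    +*-zeroˡ y refl = refl

    +*-zeroʳ : ∀ c {y} → y ≡ + 0 → + c * y ≡ + 0
    +*-zeroʳ c refl = ℤP.*-zeroʳ (+ c)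

    step-< : ∀ d {i a} → i < a → suc (d ℕ.+ i) < d ℕ.+ suc a
    step-< d {i} {a} lt = subst (suc (d ℕ.+ i) <_) (sym (ℕP.+-suc d a)) (s≤s (ℕP.+-monoʳ-< d lt))

  -- The sums over the first entry t = suc a of rhsFrom-leftFirst and rhsFrom-rightFirst, when the
  -- letter is read from a word whose current block has h x₀'s.  In sameStep the previous letter came
  -- from the same word and d counts the x₀'s taken from the other word; in switchStep it came from
  -- the other word and d counts the x₀'s of this block already taken.  Next is the rest of the
  -- right-hand side as a function of the test function, the new deficit and the remaining total.
  module Step (Next : (BWord → ℤ) → ℤ → ℕ → ℤ) (lab : A) where

    sameStep : (BWord → ℤ) → ℕ → ℕ → ℕ → ℕ → ℤ
    sameStep f h d N a =
      + (a C h) * Next (f ∘ ((suc a , lab) ∷_)) (deficitAfter (+ d) (suc a) (suc h)) (N ∸ suc a)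

    switchStep : (BWord → ℤ) → ℕ → ℕ → ℕ → ℕ → ℤ
    switchStep f h d N a =
      + binomℤ a (deficitAfter (+ d) (suc a) (suc h))
        * Next (f ∘ ((suc a , lab) ∷_)) (deficitAfter (+ d) (suc a) (suc h)) (N ∸ suc a)

    VanishesBeyond : ℕ → ℕ → Set c
    VanishesBeyond g R = ∀ f d N → g < d → N ℕ.+ d ≡ R → Next f (+ d) N ≡ + 0

    next-overdrawn : ∀ {g R} → VanishesBeyond g R → ∀ f h d N a → a < N → N ℕ.+ d ≡ suc h ℕ.+ R →
      suc h ℕ.+ g < d ℕ.+ suc a → Next f (deficitAfter (+ d) (suc a) (suc h)) (N ∸ suc a) ≡ + 0
    next-overdrawn {g} vanish f h d N a a<N eq lt = begin
      Next f (deficitAfter (+ d) (suc a) (suc h)) (N ∸ suc a)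
        ≡⟨ cong (λ u → Next f u (N ∸ suc a)) (deficitAfter-≡ d (suc a) (suc h) e (overdrawn-≡ d (suc a) (suc h) g lt)) ⟩
      Next f (+ e) (N ∸ suc a)
        ≡⟨ vanish f e (N ∸ suc a) (overdrawn-< d (suc a) (suc h) g lt) (∸-balance (suc a) (suc h) e a<N (overdrawn-≡ d (suc a) (suc h) g lt) eq) ⟩
      + 0 ∎
      where
      open ≡-Reasoning
      e : ℕ
      e = d ℕ.+ suc a ∸ suc h

    sameStep-overdrawn : ∀ {g R} → VanishesBeyond g R → ∀ f h d N → g < d → N ℕ.+ d ≡ suc h ℕ.+ R →
      sumUpTo (sameStep f h d N) N ≡ + 0
    sameStep-overdrawn {g} vanish f h d N g<d eq = sumUpTo-zero N _ term
      where
      term : ∀ a → a < N → sameStep f h d N a ≡ + 0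
      term a a<N with a ℕ.<? h
      ... | yes a<h = +*-zeroˡ _ (k>n⇒nCk≡0 a<h)
      ... | no  a≮h = +*-zeroʳ (a C h) (next-overdrawn vanish (f ∘ ((suc a , lab) ∷_)) h d N a a<N eq
            (subst (suc h ℕ.+ g <_) (trans (cong suc (ℕP.+-comm a d)) (sym (ℕP.+-suc d a)))
                   (s≤s (ℕP.+-mono-≤-< (ℕP.≮⇒≥ a≮h) g<d))))

    switchStep-overdrawn : ∀ f h d N → h < d → sumUpTo (switchStep f h d N) N ≡ + 0
    switchStep-overdrawn f h d N h<d = sumUpTo-zero N _ λ a _ →
      let lt = subst (_< d ℕ.+ suc a) (ℕP.+-suc h a) (ℕP.+-mono-<-≤ h<d (ℕP.≤-refl {suc a})) in
      +*-zeroˡ _ (trans (cong (binomℤ a) (deficitAfter-≡ d (suc a) (suc h) _ (overdrawn-≡ d (suc a) (suc h) a lt)))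
                       (k>n⇒nCk≡0 (overdrawn-< d (suc a) (suc h) a lt)))

    module _ {g R : ℕ} (vanish : VanishesBeyond g R) (g≤R : g ≤ R)
             (Sh : ℕ → List (List Letter)) (α γ : A) (γ/α≈lab : γ / α ≈ lab)
             (solves : ∀ f → Respects f → ∀ d N → d ≤ g → N ℕ.+ d ≡ R →
                         sumList (Sh d) (f ∘ ηGo α 0) ≡ Next f (+ d) N)
             (f : BWord → ℤ) (resp : Respects f) where

      blockTerm : ℕ → ℕ → ℤ
      blockTerm p d = sumList (Sh d) (λ W → f (ηGo γ 0 (x₀^ p ++ x α ∷ W)))

      next≡blockTerm : ∀ p d N → d ≤ g → N ℕ.+ d ≡ R → Next (f ∘ ((suc p , lab) ∷_)) (+ d) N ≡ blockTerm p d
      next≡blockTerm p d N d≤g eq =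
        trans (sym (solves _ (respects-∷ _ resp) d N d≤g eq))
              (sumList-cong (Sh d) (λ W → sym (respects-block resp γ/α≈lab p W)))

      sameStep-window : ∀ h d N → d ≤ g → N ℕ.+ d ≡ suc h ℕ.+ R →
        sumUpTo (sameStep f h d N) N
        ≡ sumUpTo (λ m → + ((h ℕ.+ m) C h) * blockTerm (h ℕ.+ m) (d ℕ.+ m)) (suc (g ∸ d))
      sameStep-window h d N d≤g eq with ℕP.m≤n⇒∃[o]m+o≡n d≤g
      ... | c , refl rewrite ℕP.m+n∸m≡n d c =
        trans (sumUpTo-window _ h c N fits below above) (sumUpTo-cong (suc c) inWindow)
        where
        fits : h ℕ.+ c < N
        fits = <-from-+≤ d h R (subst (_≤ h ℕ.+ R) (sym (ℕP.+-assoc h c d)) (ℕP.+-monoʳ-≤ h (subst (_≤ R) (ℕP.+-comm d c) g≤R))) eq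
        below : ∀ a → a < h → sameStep f h d N a ≡ + 0
        below a a<h = +*-zeroˡ _ (k>n⇒nCk≡0 a<h)
        above : ∀ a → h ℕ.+ c < a → a < N → sameStep f h d N a ≡ + 0
        above a lt a<N = +*-zeroʳ (a C h) (next-overdrawn vanish (f ∘ ((suc a , lab) ∷_)) h d N a a<N eq
          (subst (_< d ℕ.+ suc a) (cong suc (reorder d h c)) (step-< d lt)))
          where
          reorder : ∀ d h c → d ℕ.+ (h ℕ.+ c) ≡ h ℕ.+ (d ℕ.+ c)
          reorder = solve-∀
        inWindow : ∀ m → m < suc c → sameStep f h d N (h ℕ.+ m) ≡ + ((h ℕ.+ m) C h) * blockTerm (h ℕ.+ m) (d ℕ.+ m)
        inWindow m m≤c = cong (+ ((h ℕ.+ m) C h) *_) (begin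
          Next f′ (deficitAfter (+ d) (suc (h ℕ.+ m)) (suc h)) (N ∸ suc (h ℕ.+ m))
            ≡⟨ cong (λ u → Next f′ u (N ∸ suc (h ℕ.+ m))) (deficitAfter-≡ d (suc (h ℕ.+ m)) (suc h) (d ℕ.+ m) step) ⟩
          Next f′ (+ (d ℕ.+ m)) (N ∸ suc (h ℕ.+ m))
            ≡⟨ next≡blockTerm (h ℕ.+ m) (d ℕ.+ m) _ (ℕP.+-monoʳ-≤ d (ℕP.≤-pred m≤c))
                 (∸-balance (suc (h ℕ.+ m)) (suc h) (d ℕ.+ m) (ℕP.≤-<-trans (ℕP.+-monoʳ-≤ h (ℕP.≤-pred m≤c)) fits) step eq) ⟩
          blockTerm (h ℕ.+ m) (d ℕ.+ m) ∎)
          where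
          open ≡-Reasoning
          f′ : BWord → ℤ
          f′ = f ∘ ((suc (h ℕ.+ m) , lab) ∷_)
          step : suc h ℕ.+ (d ℕ.+ m) ≡ d ℕ.+ suc (h ℕ.+ m)
          step = reorder h d m
            where
            reorder : ∀ h d m → suc h ℕ.+ (d ℕ.+ m) ≡ d ℕ.+ suc (h ℕ.+ m)
            reorder = solve-∀

      switchStep-window : ∀ h d N → d ≤ h → N ℕ.+ d ≡ suc h ℕ.+ R →
        sumUpTo (switchStep f h d N) N
        ≡ sumUpTo (λ m → + (((h ∸ d) ℕ.+ m) C (h ∸ d)) * blockTerm ((h ∸ d) ℕ.+ m) m) (suc g)
      switchStep-window h d N d≤h eq with ℕP.m≤n⇒∃[o]m+o≡n d≤h
      ... | b , refl rewrite ℕP.m+n∸m≡n d b =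
        trans (sumUpTo-window _ b g N fits below above) (sumUpTo-cong (suc g) inWindow)
        where
        fits : b ℕ.+ g < N
        fits = <-from-+≤ d (d ℕ.+ b) R (subst (_≤ d ℕ.+ b ℕ.+ R) (reorder d b g) (ℕP.+-monoʳ-≤ (d ℕ.+ b) g≤R)) eq
          where
          reorder : ∀ d b g → d ℕ.+ b ℕ.+ g ≡ b ℕ.+ g ℕ.+ d
          reorder = solve-∀
        below : ∀ a → a < b → switchStep f (d ℕ.+ b) d N a ≡ + 0
        below a a<b = +*-zeroˡ _ (binomℤ-deficitAfter-< a d (suc a) (suc (d ℕ.+ b)) (s≤s (ℕP.+-monoʳ-≤ d a<b)))
        above : ∀ a → b ℕ.+ g < a → a < N → switchStep f (d ℕ.+ b) d N a ≡ + 0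
        above a lt a<N = +*-zeroʳ (binomℤ a (deficitAfter (+ d) (suc a) (suc (d ℕ.+ b)))) (next-overdrawn vanish (f ∘ ((suc a , lab) ∷_)) (d ℕ.+ b) d N a a<N eq
          (subst (_< d ℕ.+ suc a) (cong suc (sym (ℕP.+-assoc d b g))) (step-< d lt)))
        inWindow : ∀ m → m < suc g → switchStep f (d ℕ.+ b) d N (b ℕ.+ m) ≡ + ((b ℕ.+ m) C b) * blockTerm (b ℕ.+ m) m
        inWindow m m≤g = begin
          + binomℤ (b ℕ.+ m) δ * Next f′ δ (N ∸ suc (b ℕ.+ m))
            ≡⟨ cong (λ u → + binomℤ (b ℕ.+ m) u * Next f′ u (N ∸ suc (b ℕ.+ m))) δ≡m ⟩
          + binomℤ (b ℕ.+ m) (+ m) * Next f′ (+ m) (N ∸ suc (b ℕ.+ m))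
            ≡⟨ cong₂ (λ u v → + u * v) (binomℤ-+ b m)
                 (next≡blockTerm (b ℕ.+ m) m _ (ℕP.≤-pred m≤g)
                   (∸-balance (suc (b ℕ.+ m)) (suc (d ℕ.+ b)) m (ℕP.≤-<-trans (ℕP.+-monoʳ-≤ b (ℕP.≤-pred m≤g)) fits) step eq)) ⟩
          + ((b ℕ.+ m) C b) * blockTerm (b ℕ.+ m) m ∎
          where
          open ≡-Reasoning
          f′ : BWord → ℤ
          f′ = f ∘ ((suc (b ℕ.+ m) , lab) ∷_)
          δ : ℤ
          δ = deficitAfter (+ d) (suc (b ℕ.+ m)) (suc (d ℕ.+ b))
          step : suc (d ℕ.+ b) ℕ.+ m ≡ d ℕ.+ suc (b ℕ.+ m)
          step = reorder d b m
            where
            reorder : ∀ d b m → suc (d ℕ.+ b) ℕ.+ m ≡ d ℕ.+ suc (b ℕ.+ m)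
            reorder = solve-∀
          δ≡m : δ ≡ + m
          δ≡m = deficitAfter-≡ d (suc (b ℕ.+ m)) (suc (d ℕ.+ b)) m step

  -- Induction on the number of remaining entries

  private
    sum-swap : ∀ a b c → a ℕ.+ (b ℕ.+ c) ≡ b ℕ.+ (a ℕ.+ c)
    sum-swap = solve-∀

    length-suc : ∀ {n k l} → suc n ≡ suc k ℕ.+ suc l → n ≡ suc k ℕ.+ l
    length-suc {k = k} {l} eq = trans (ℕP.suc-injective eq) (ℕP.+-suc k l)

  rhsFrom-afterLeft-overdrawn : ∀ n f Pw Pz (r : Vec ℕ k) → All (1 ≤_) r → ∀ w (s : Vec ℕ l) → All (1 ≤_) s →
    ∀ z d N → leadingX₀ s < d → n ≡ k ℕ.+ l → N ℕ.+ d ≡ entrySum r ℕ.+ entrySum s →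
    rhsFrom f (just true) (+ d) Pw Pz r w s z n N ≡ + 0
  rhsFrom-afterRight-overdrawn : ∀ n f Pw Pz (r : Vec ℕ k) → All (1 ≤_) r → ∀ w (s : Vec ℕ l) → All (1 ≤_) s →
    ∀ z d N → leadingX₀ r < d → n ≡ k ℕ.+ l → N ℕ.+ d ≡ entrySum r ℕ.+ entrySum s →
    rhsFrom f (just false) (+ d) Pw Pz r w s z n N ≡ + 0

  rhsFrom-afterLeft-overdrawn zero f Pw Pz [] [] [] [] [] [] (suc d) N _ _ eq
    with () ← trans (sym (ℕP.+-suc N d)) eq
  rhsFrom-afterLeft-overdrawn (suc n) f Pw Pz (suc ra ∷ r) (s≤s z≤n ∷ pr) (w₁ ∷ w) (suc sb ∷ s) ps@(s≤s z≤n ∷ _) (z₁ ∷ z) d N sb<d n≡ eq =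
    trans (rhsFrom-∷-∷ f (just true) (+ d) Pw Pz (suc ra) r w₁ w (suc sb) s z₁ z n N)
      (cong₂ _+_
        (Step.sameStep-overdrawn (λ f′ d′ N′ → rhsFrom f′ (just true) d′ (Pw ∙ w₁) Pz r w (suc sb ∷ s) (z₁ ∷ z) n N′) w₁
          (λ f′ d′ N′ lt → rhsFrom-afterLeft-overdrawn n f′ (Pw ∙ w₁) Pz r pr w (suc sb ∷ s) ps (z₁ ∷ z) d′ N′ lt (ℕP.suc-injective n≡))
          f ra d N sb<d (trans eq (ℕP.+-assoc (suc ra) (entrySum r) _)))
        (Step.switchStep-overdrawn (λ f′ d′ N′ → rhsFrom f′ (just false) d′ Pw (Pz ∙ z₁) (suc ra ∷ r) (w₁ ∷ w) s z n N′)
          ((Pz ∙ z₁) / Pw) f sb d N sb<d))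
  rhsFrom-afterLeft-overdrawn (suc n) f Pw Pz [] [] [] (suc sb ∷ s) (s≤s z≤n ∷ _) (z₁ ∷ z) d N sb<d _ _ =
    trans (rhsFrom-[]-∷ f (just true) (+ d) Pw Pz (suc sb) s z₁ z n N)
      (Step.switchStep-overdrawn (λ f′ d′ N′ → rhsFrom f′ (just false) d′ Pw (Pz ∙ z₁) [] [] s z n N′)
        ((Pz ∙ z₁) / Pw) f sb d N sb<d)
  rhsFrom-afterLeft-overdrawn (suc n) f Pw Pz (suc ra ∷ r) (s≤s z≤n ∷ pr) (w₁ ∷ w) [] [] [] d N 0<d n≡ eq =
    trans (rhsFrom-∷-[] f (just true) (+ d) Pw Pz (suc ra) r w₁ w n N)
      (Step.sameStep-overdrawn (λ f′ d′ N′ → rhsFrom f′ (just true) d′ (Pw ∙ w₁) Pz r w [] [] n N′) w₁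
        (λ f′ d′ N′ lt → rhsFrom-afterLeft-overdrawn n f′ (Pw ∙ w₁) Pz r pr w [] [] [] d′ N′ lt (ℕP.suc-injective n≡))
        f ra d N 0<d (trans eq (ℕP.+-assoc (suc ra) (entrySum r) 0)))

  rhsFrom-afterRight-overdrawn zero f Pw Pz [] [] [] [] [] [] (suc d) N _ _ eq
    with () ← trans (sym (ℕP.+-suc N d)) eq
  rhsFrom-afterRight-overdrawn (suc n) f Pw Pz (suc ra ∷ r) pr@(s≤s z≤n ∷ _) (w₁ ∷ w) (suc sb ∷ s) (s≤s z≤n ∷ ps) (z₁ ∷ z) d N ra<d n≡ eq =
    trans (rhsFrom-∷-∷ f (just false) (+ d) Pw Pz (suc ra) r w₁ w (suc sb) s z₁ z n N)
      (cong₂ _+_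
        (Step.switchStep-overdrawn (λ f′ d′ N′ → rhsFrom f′ (just true) d′ (Pw ∙ w₁) Pz r w (suc sb ∷ s) (z₁ ∷ z) n N′)
          ((Pw ∙ w₁) / Pz) f ra d N ra<d)
        (Step.sameStep-overdrawn (λ f′ d′ N′ → rhsFrom f′ (just false) d′ Pw (Pz ∙ z₁) (suc ra ∷ r) (w₁ ∷ w) s z n N′) z₁
          (λ f′ d′ N′ lt → rhsFrom-afterRight-overdrawn n f′ Pw (Pz ∙ z₁) (suc ra ∷ r) pr (w₁ ∷ w) s ps z d′ N′ lt (length-suc n≡))
          f sb d N ra<d (trans eq (sum-swap (entrySum (suc ra ∷ r)) (suc sb) (entrySum s)))))
  rhsFrom-afterRight-overdrawn (suc n) f Pw Pz [] [] [] (suc sb ∷ s) (s≤s z≤n ∷ ps) (z₁ ∷ z) d N 0<d n≡ eq =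
    trans (rhsFrom-[]-∷ f (just false) (+ d) Pw Pz (suc sb) s z₁ z n N)
      (Step.sameStep-overdrawn (λ f′ d′ N′ → rhsFrom f′ (just false) d′ Pw (Pz ∙ z₁) [] [] s z n N′) z₁
        (λ f′ d′ N′ lt → rhsFrom-afterRight-overdrawn n f′ Pw (Pz ∙ z₁) [] [] [] s ps z d′ N′ lt (ℕP.suc-injective n≡))
        f sb d N 0<d eq)
  rhsFrom-afterRight-overdrawn (suc n) f Pw Pz (suc ra ∷ r) (s≤s z≤n ∷ _) (w₁ ∷ w) [] [] [] d N ra<d _ _ =
    trans (rhsFrom-∷-[] f (just false) (+ d) Pw Pz (suc ra) r w₁ w n N)
      (Step.switchStep-overdrawn (λ f′ d′ N′ → rhsFrom f′ (just true) d′ (Pw ∙ w₁) Pz r w [] [] n N′)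
        ((Pw ∙ w₁) / Pz) f ra d N ra<d)

  sumShuffle≡rhsFrom-afterLeft : ∀ n f → Respects f → ∀ Pw Pz (r : Vec ℕ k) → All (1 ≤_) r → ∀ w (s : Vec ℕ l) → All (1 ≤_) s →
    ∀ z d N → d ≤ leadingX₀ s → n ≡ k ℕ.+ l → N ℕ.+ d ≡ entrySum r ℕ.+ entrySum s →
    sumList (shuffle (lettersOf Pw r w) (lettersOf-dropX₀ d Pz s z)) (λ W → f (ηGo (Pw ⁻¹) 0 W))
    ≡ rhsFrom f (just true) (+ d) Pw Pz r w s z n N
  sumShuffle≡rhsFrom-afterRight : ∀ n f → Respects f → ∀ Pw Pz (r : Vec ℕ k) → All (1 ≤_) r → ∀ w (s : Vec ℕ l) → All (1 ≤_) s →
    ∀ z d N → d ≤ leadingX₀ r → n ≡ k ℕ.+ l → N ℕ.+ d ≡ entrySum r ℕ.+ entrySum s →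
    sumList (shuffle (lettersOf-dropX₀ d Pw r w) (lettersOf Pz s z)) (λ W → f (ηGo (Pz ⁻¹) 0 W))
    ≡ rhsFrom f (just false) (+ d) Pw Pz r w s z n N

  sumShuffle≡rhsFrom-afterLeft zero f _ Pw Pz [] [] [] [] [] [] zero N z≤n _ eq = rhsFrom-[] f (just true) (+ 0) Pw Pz N eq
  sumShuffle≡rhsFrom-afterLeft (suc n) f resp Pw Pz (suc ra ∷ r) pr@(s≤s z≤n ∷ pr′) (w₁ ∷ w) (suc sb ∷ s) ps@(s≤s z≤n ∷ ps′) (z₁ ∷ z) d N d≤sb n≡ eq = begin
    sumList (shuffle (x₀^ ra ++ x α ∷ U) (x₀^ (sb ∸ d) ++ x β ∷ V)) F
      ≡⟨ sumList-shuffle-blocks ra (sb ∸ d) F ⟩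
    expansion ra (sb ∸ d) F
      ≡⟨ cong₂ _+_ (trans αFirst≡ (sym leftFirst)) (sym rightFirst) ⟩
    rhsFrom-leftFirst f (just true) (+ d) Pw Pz (suc ra) r w₁ w (suc sb ∷ s) (z₁ ∷ z) n N
      + rhsFrom-rightFirst f (just true) (+ d) Pw Pz (suc ra ∷ r) (w₁ ∷ w) (suc sb) s z₁ z n N
      ≡⟨ rhsFrom-∷-∷ f (just true) (+ d) Pw Pz (suc ra) r w₁ w (suc sb) s z₁ z n N ⟨
    rhsFrom f (just true) (+ d) Pw Pz (suc ra ∷ r) (w₁ ∷ w) (suc sb ∷ s) (z₁ ∷ z) (suc n) N ∎
    where
    open ≡-Reasoning
    α β : A
    α = (Pw ∙ w₁) ⁻¹
    β = (Pz ∙ z₁) ⁻¹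
    U V : List Letter
    U = lettersOf (Pw ∙ w₁) r w
    V = lettersOf (Pz ∙ z₁) s z
    open FirstBlocks α β U V
    F : List Letter → ℤ
    F W = f (ηGo (Pw ⁻¹) 0 W)
    αFirstSum : ℤ
    αFirstSum = sumUpTo (λ m → + ((ra ℕ.+ m) C ra)
      * sumList (shuffle U (x₀^ (sb ∸ (d ℕ.+ m)) ++ x β ∷ V)) (λ W → F (x₀^ (ra ℕ.+ m) ++ x α ∷ W))) (suc (sb ∸ d))
    αFirst≡ : sumUpTo (λ m → + ((ra ℕ.+ m) C ra) * αFirst ra (sb ∸ d) F m) (suc (sb ∸ d)) ≡ αFirstSum
    αFirst≡ = sumUpTo-cong (suc (sb ∸ d)) λ m _ → cong (λ q → + ((ra ℕ.+ m) C ra)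
      * sumList (shuffle U (x₀^ q ++ x β ∷ V)) (λ W → F (x₀^ (ra ℕ.+ m) ++ x α ∷ W))) (ℕP.∸-+-assoc sb d m)
    leftFirst : rhsFrom-leftFirst f (just true) (+ d) Pw Pz (suc ra) r w₁ w (suc sb ∷ s) (z₁ ∷ z) n N ≡ αFirstSum
    leftFirst = Step.sameStep-window
      (λ f′ d′ N′ → rhsFrom f′ (just true) d′ (Pw ∙ w₁) Pz r w (suc sb ∷ s) (z₁ ∷ z) n N′) w₁
      (λ f′ d′ N′ lt → rhsFrom-afterLeft-overdrawn n f′ (Pw ∙ w₁) Pz r pr′ w (suc sb ∷ s) ps (z₁ ∷ z) d′ N′ lt (ℕP.suc-injective n≡))
      (ℕP.≤-trans (leadingX₀≤entrySum (suc sb ∷ s)) (ℕP.m≤n+m _ (entrySum r)))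
      (λ d′ → shuffle U (lettersOf-dropX₀ d′ Pz (suc sb ∷ s) (z₁ ∷ z))) α (Pw ⁻¹) (inv-/-inv-∙ Pw w₁)
      (λ f′ resp′ d′ N′ le → sumShuffle≡rhsFrom-afterLeft n f′ resp′ (Pw ∙ w₁) Pz r pr′ w (suc sb ∷ s) ps (z₁ ∷ z) d′ N′ le (ℕP.suc-injective n≡))
      f resp ra d N d≤sb (trans eq (ℕP.+-assoc (suc ra) (entrySum r) _))
    rightFirst : rhsFrom-rightFirst f (just true) (+ d) Pw Pz (suc ra ∷ r) (w₁ ∷ w) (suc sb) s z₁ z n N
               ≡ sumUpTo (λ m → + (((sb ∸ d) ℕ.+ m) C (sb ∸ d)) * βFirst ra (sb ∸ d) F m) (suc ra)
    rightFirst = Step.switchStep-window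
      (λ f′ d′ N′ → rhsFrom f′ (just false) d′ Pw (Pz ∙ z₁) (suc ra ∷ r) (w₁ ∷ w) s z n N′) ((Pz ∙ z₁) / Pw)
      (λ f′ d′ N′ lt → rhsFrom-afterRight-overdrawn n f′ Pw (Pz ∙ z₁) (suc ra ∷ r) pr (w₁ ∷ w) s ps′ z d′ N′ lt (length-suc n≡))
      (ℕP.≤-trans (leadingX₀≤entrySum (suc ra ∷ r)) (ℕP.m≤m+n _ (entrySum s)))
      (λ d′ → shuffle (lettersOf-dropX₀ d′ Pw (suc ra ∷ r) (w₁ ∷ w)) V) β (Pw ⁻¹) (inv-/-inv Pw (Pz ∙ z₁))
      (λ f′ resp′ d′ N′ le → sumShuffle≡rhsFrom-afterRight n f′ resp′ Pw (Pz ∙ z₁) (suc ra ∷ r) pr (w₁ ∷ w) s ps′ z d′ N′ le (length-suc n≡))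
      f resp sb d N d≤sb (trans eq (sum-swap (entrySum (suc ra ∷ r)) (suc sb) (entrySum s)))
  sumShuffle≡rhsFrom-afterLeft (suc n) f resp Pw Pz [] [] [] (suc sb ∷ s) (s≤s z≤n ∷ ps′) (z₁ ∷ z) d N d≤sb n≡ eq =
    trans (sumList-shuffle-[]-block (sb ∸ d) ((Pz ∙ z₁) ⁻¹) (lettersOf (Pz ∙ z₁) s z) (λ W → f (ηGo (Pw ⁻¹) 0 W)))
      (sym (trans (rhsFrom-[]-∷ f (just true) (+ d) Pw Pz (suc sb) s z₁ z n N)
        (Step.switchStep-window (λ f′ d′ N′ → rhsFrom f′ (just false) d′ Pw (Pz ∙ z₁) [] [] s z n N′) ((Pz ∙ z₁) / Pw)
          (λ f′ d′ N′ lt → rhsFrom-afterRight-overdrawn n f′ Pw (Pz ∙ z₁) [] [] [] s ps′ z d′ N′ lt (ℕP.suc-injective n≡))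
          z≤n (λ _ → shuffle [] (lettersOf (Pz ∙ z₁) s z)) ((Pz ∙ z₁) ⁻¹) (Pw ⁻¹) (inv-/-inv Pw (Pz ∙ z₁))
          (λ f′ resp′ d′ N′ le → sumShuffle≡rhsFrom-afterRight n f′ resp′ Pw (Pz ∙ z₁) [] [] [] s ps′ z d′ N′ le (ℕP.suc-injective n≡))
          f resp sb d N d≤sb eq)))
  sumShuffle≡rhsFrom-afterLeft (suc n) f resp Pw Pz (suc ra ∷ r) (s≤s z≤n ∷ pr′) (w₁ ∷ w) [] [] [] zero N z≤n n≡ eq =
    trans (sumList-shuffle-block-[] ra ((Pw ∙ w₁) ⁻¹) (lettersOf (Pw ∙ w₁) r w) (λ W → f (ηGo (Pw ⁻¹) 0 W)))
      (sym (trans (rhsFrom-∷-[] f (just true) (+ 0) Pw Pz (suc ra) r w₁ w n N)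
        (Step.sameStep-window (λ f′ d′ N′ → rhsFrom f′ (just true) d′ (Pw ∙ w₁) Pz r w [] [] n N′) w₁
          (λ f′ d′ N′ lt → rhsFrom-afterLeft-overdrawn n f′ (Pw ∙ w₁) Pz r pr′ w [] [] [] d′ N′ lt (ℕP.suc-injective n≡))
          z≤n (λ _ → shuffle (lettersOf (Pw ∙ w₁) r w) []) ((Pw ∙ w₁) ⁻¹) (Pw ⁻¹) (inv-/-inv-∙ Pw w₁)
          (λ f′ resp′ d′ N′ le → sumShuffle≡rhsFrom-afterLeft n f′ resp′ (Pw ∙ w₁) Pz r pr′ w [] [] [] d′ N′ le (ℕP.suc-injective n≡))
          f resp ra 0 N z≤n (trans eq (ℕP.+-assoc (suc ra) (entrySum r) 0)))))

  sumShuffle≡rhsFrom-afterRight zero f _ Pw Pz [] [] [] [] [] [] zero N z≤n _ eq = rhsFrom-[] f (just false) (+ 0) Pw Pz N eq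
  sumShuffle≡rhsFrom-afterRight (suc n) f resp Pw Pz (suc ra ∷ r) pr@(s≤s z≤n ∷ pr′) (w₁ ∷ w) (suc sb ∷ s) ps@(s≤s z≤n ∷ ps′) (z₁ ∷ z) d N d≤ra n≡ eq = begin
    sumList (shuffle (x₀^ (ra ∸ d) ++ x α ∷ U) (x₀^ sb ++ x β ∷ V)) F
      ≡⟨ sumList-shuffle-blocks (ra ∸ d) sb F ⟩
    expansion (ra ∸ d) sb F
      ≡⟨ cong₂ _+_ (sym leftFirst) (trans βFirst≡ (sym rightFirst)) ⟩
    rhsFrom-leftFirst f (just false) (+ d) Pw Pz (suc ra) r w₁ w (suc sb ∷ s) (z₁ ∷ z) n N
      + rhsFrom-rightFirst f (just false) (+ d) Pw Pz (suc ra ∷ r) (w₁ ∷ w) (suc sb) s z₁ z n N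
      ≡⟨ rhsFrom-∷-∷ f (just false) (+ d) Pw Pz (suc ra) r w₁ w (suc sb) s z₁ z n N ⟨
    rhsFrom f (just false) (+ d) Pw Pz (suc ra ∷ r) (w₁ ∷ w) (suc sb ∷ s) (z₁ ∷ z) (suc n) N ∎
    where
    open ≡-Reasoning
    α β : A
    α = (Pw ∙ w₁) ⁻¹
    β = (Pz ∙ z₁) ⁻¹
    U V : List Letter
    U = lettersOf (Pw ∙ w₁) r w
    V = lettersOf (Pz ∙ z₁) s z
    open FirstBlocks α β U V
    F : List Letter → ℤ
    F W = f (ηGo (Pz ⁻¹) 0 W)
    βFirstSum : ℤ
    βFirstSum = sumUpTo (λ m → + ((sb ℕ.+ m) C sb)
      * sumList (shuffle (x₀^ (ra ∸ (d ℕ.+ m)) ++ x α ∷ U) V) (λ W → F (x₀^ (sb ℕ.+ m) ++ x β ∷ W))) (suc (ra ∸ d))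
    βFirst≡ : sumUpTo (λ m → + ((sb ℕ.+ m) C sb) * βFirst (ra ∸ d) sb F m) (suc (ra ∸ d)) ≡ βFirstSum
    βFirst≡ = sumUpTo-cong (suc (ra ∸ d)) λ m _ → cong (λ q → + ((sb ℕ.+ m) C sb)
      * sumList (shuffle (x₀^ q ++ x α ∷ U) V) (λ W → F (x₀^ (sb ℕ.+ m) ++ x β ∷ W))) (ℕP.∸-+-assoc ra d m)
    leftFirst : rhsFrom-leftFirst f (just false) (+ d) Pw Pz (suc ra) r w₁ w (suc sb ∷ s) (z₁ ∷ z) n N
              ≡ sumUpTo (λ m → + (((ra ∸ d) ℕ.+ m) C (ra ∸ d)) * αFirst (ra ∸ d) sb F m) (suc sb)
    leftFirst = Step.switchStep-window
      (λ f′ d′ N′ → rhsFrom f′ (just true) d′ (Pw ∙ w₁) Pz r w (suc sb ∷ s) (z₁ ∷ z) n N′) ((Pw ∙ w₁) / Pz)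
      (λ f′ d′ N′ lt → rhsFrom-afterLeft-overdrawn n f′ (Pw ∙ w₁) Pz r pr′ w (suc sb ∷ s) ps (z₁ ∷ z) d′ N′ lt (ℕP.suc-injective n≡))
      (ℕP.≤-trans (leadingX₀≤entrySum (suc sb ∷ s)) (ℕP.m≤n+m _ (entrySum r)))
      (λ d′ → shuffle U (lettersOf-dropX₀ d′ Pz (suc sb ∷ s) (z₁ ∷ z))) α (Pz ⁻¹) (inv-/-inv Pz (Pw ∙ w₁))
      (λ f′ resp′ d′ N′ le → sumShuffle≡rhsFrom-afterLeft n f′ resp′ (Pw ∙ w₁) Pz r pr′ w (suc sb ∷ s) ps (z₁ ∷ z) d′ N′ le (ℕP.suc-injective n≡))
      f resp ra d N d≤ra (trans eq (ℕP.+-assoc (suc ra) (entrySum r) _))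
    rightFirst : rhsFrom-rightFirst f (just false) (+ d) Pw Pz (suc ra ∷ r) (w₁ ∷ w) (suc sb) s z₁ z n N ≡ βFirstSum
    rightFirst = Step.sameStep-window
      (λ f′ d′ N′ → rhsFrom f′ (just false) d′ Pw (Pz ∙ z₁) (suc ra ∷ r) (w₁ ∷ w) s z n N′) z₁
      (λ f′ d′ N′ lt → rhsFrom-afterRight-overdrawn n f′ Pw (Pz ∙ z₁) (suc ra ∷ r) pr (w₁ ∷ w) s ps′ z d′ N′ lt (length-suc n≡))
      (ℕP.≤-trans (leadingX₀≤entrySum (suc ra ∷ r)) (ℕP.m≤m+n _ (entrySum s)))
      (λ d′ → shuffle (lettersOf-dropX₀ d′ Pw (suc ra ∷ r) (w₁ ∷ w)) V) β (Pz ⁻¹) (inv-/-inv-∙ Pz z₁)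
      (λ f′ resp′ d′ N′ le → sumShuffle≡rhsFrom-afterRight n f′ resp′ Pw (Pz ∙ z₁) (suc ra ∷ r) pr (w₁ ∷ w) s ps′ z d′ N′ le (length-suc n≡))
      f resp sb d N d≤ra (trans eq (sum-swap (entrySum (suc ra ∷ r)) (suc sb) (entrySum s)))
  sumShuffle≡rhsFrom-afterRight (suc n) f resp Pw Pz [] [] [] (suc sb ∷ s) (s≤s z≤n ∷ ps′) (z₁ ∷ z) zero N z≤n n≡ eq =
    trans (sumList-shuffle-[]-block sb ((Pz ∙ z₁) ⁻¹) (lettersOf (Pz ∙ z₁) s z) (λ W → f (ηGo (Pz ⁻¹) 0 W)))
      (sym (trans (rhsFrom-[]-∷ f (just false) (+ 0) Pw Pz (suc sb) s z₁ z n N)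
        (Step.sameStep-window (λ f′ d′ N′ → rhsFrom f′ (just false) d′ Pw (Pz ∙ z₁) [] [] s z n N′) z₁
          (λ f′ d′ N′ lt → rhsFrom-afterRight-overdrawn n f′ Pw (Pz ∙ z₁) [] [] [] s ps′ z d′ N′ lt (ℕP.suc-injective n≡))
          z≤n (λ _ → shuffle [] (lettersOf (Pz ∙ z₁) s z)) ((Pz ∙ z₁) ⁻¹) (Pz ⁻¹) (inv-/-inv-∙ Pz z₁)
          (λ f′ resp′ d′ N′ le → sumShuffle≡rhsFrom-afterRight n f′ resp′ Pw (Pz ∙ z₁) [] [] [] s ps′ z d′ N′ le (ℕP.suc-injective n≡))
          f resp sb 0 N z≤n eq)))
  sumShuffle≡rhsFrom-afterRight (suc n) f resp Pw Pz (suc ra ∷ r) (s≤s z≤n ∷ pr′) (w₁ ∷ w) [] [] [] d N d≤ra n≡ eq =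
    trans (sumList-shuffle-block-[] (ra ∸ d) ((Pw ∙ w₁) ⁻¹) (lettersOf (Pw ∙ w₁) r w) (λ W → f (ηGo (Pz ⁻¹) 0 W)))
      (sym (trans (rhsFrom-∷-[] f (just false) (+ d) Pw Pz (suc ra) r w₁ w n N)
        (Step.switchStep-window (λ f′ d′ N′ → rhsFrom f′ (just true) d′ (Pw ∙ w₁) Pz r w [] [] n N′) ((Pw ∙ w₁) / Pz)
          (λ f′ d′ N′ lt → rhsFrom-afterLeft-overdrawn n f′ (Pw ∙ w₁) Pz r pr′ w [] [] [] d′ N′ lt (ℕP.suc-injective n≡))
          z≤n (λ _ → shuffle (lettersOf (Pw ∙ w₁) r w) []) ((Pw ∙ w₁) ⁻¹) (Pz ⁻¹) (inv-/-inv Pz (Pw ∙ w₁))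
          (λ f′ resp′ d′ N′ le → sumShuffle≡rhsFrom-afterLeft n f′ resp′ (Pw ∙ w₁) Pz r pr′ w [] [] [] d′ N′ le (ℕP.suc-injective n≡))
          f resp ra d N d≤ra (trans eq (ℕP.+-assoc (suc ra) (entrySum r) 0)))))

  sumShuffle≡rhsFrom : ∀ f → Respects f → (r : Vec ℕ (suc k)) → All (1 ≤_) r → ∀ w (s : Vec ℕ (suc l)) → All (1 ≤_) s → ∀ z →
    sumList (shuffle (η⁻¹ (mkWord (toList r) (toList w))) (η⁻¹ (mkWord (toList s) (toList z)))) (f ∘ η)
    ≡ rhsFrom f nothing (+ 0) ε ε r w s z (suc k ℕ.+ suc l) (entrySum r ℕ.+ entrySum s)
  sumShuffle≡rhsFrom {k} {l} f resp (suc ra ∷ r) pr@(s≤s z≤n ∷ pr′) (w₁ ∷ w) (suc sb ∷ s) ps@(s≤s z≤n ∷ ps′) (z₁ ∷ z) = begin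
    sumList (shuffle (x₀^ ra ++ x α ∷ U) (x₀^ sb ++ x β ∷ V)) (f ∘ η)
      ≡⟨ sumList-shuffle-blocks ra sb (f ∘ η) ⟩
    expansion ra sb (f ∘ η)
      ≡⟨ cong₂ _+_ (sym leftFirst) (sym rightFirst) ⟩
    rhsFrom-leftFirst f nothing (+ 0) ε ε (suc ra) r w₁ w (suc sb ∷ s) (z₁ ∷ z) n N
      + rhsFrom-rightFirst f nothing (+ 0) ε ε (suc ra ∷ r) (w₁ ∷ w) (suc sb) s z₁ z n N
      ≡⟨ rhsFrom-∷-∷ f nothing (+ 0) ε ε (suc ra) r w₁ w (suc sb) s z₁ z n N ⟨
    rhsFrom f nothing (+ 0) ε ε (suc ra ∷ r) (w₁ ∷ w) (suc sb ∷ s) (z₁ ∷ z) (suc n) N ∎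
    where
    open ≡-Reasoning
    n N : ℕ
    n = k ℕ.+ suc l
    N = entrySum (suc ra ∷ r) ℕ.+ entrySum (suc sb ∷ s)
    α β : A
    α = (ε ∙ w₁) ⁻¹
    β = (ε ∙ z₁) ⁻¹
    U V : List Letter
    U = lettersOf (ε ∙ w₁) r w
    V = lettersOf (ε ∙ z₁) s z
    open FirstBlocks α β U V
    leftFirst : rhsFrom-leftFirst f nothing (+ 0) ε ε (suc ra) r w₁ w (suc sb ∷ s) (z₁ ∷ z) n N
              ≡ sumUpTo (λ m → + ((ra ℕ.+ m) C ra) * αFirst ra sb (f ∘ η) m) (suc sb)
    leftFirst = Step.sameStep-window
      (λ f′ d′ N′ → rhsFrom f′ (just true) d′ (ε ∙ w₁) ε r w (suc sb ∷ s) (z₁ ∷ z) n N′) w₁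
      (λ f′ d′ N′ lt → rhsFrom-afterLeft-overdrawn n f′ (ε ∙ w₁) ε r pr′ w (suc sb ∷ s) ps (z₁ ∷ z) d′ N′ lt refl)
      (ℕP.≤-trans (leadingX₀≤entrySum (suc sb ∷ s)) (ℕP.m≤n+m _ (entrySum r)))
      (λ d′ → shuffle U (lettersOf-dropX₀ d′ ε (suc sb ∷ s) (z₁ ∷ z))) α ε (ε-/-inv-∙ w₁)
      (λ f′ resp′ d′ N′ le → sumShuffle≡rhsFrom-afterLeft n f′ resp′ (ε ∙ w₁) ε r pr′ w (suc sb ∷ s) ps (z₁ ∷ z) d′ N′ le refl)
      f resp ra 0 N z≤n (trans (ℕP.+-identityʳ N) (ℕP.+-assoc (suc ra) (entrySum r) _))
    rightFirst : rhsFrom-rightFirst f nothing (+ 0) ε ε (suc ra ∷ r) (w₁ ∷ w) (suc sb) s z₁ z n N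
               ≡ sumUpTo (λ m → + ((sb ℕ.+ m) C sb) * βFirst ra sb (f ∘ η) m) (suc ra)
    rightFirst = Step.sameStep-window
      (λ f′ d′ N′ → rhsFrom f′ (just false) d′ ε (ε ∙ z₁) (suc ra ∷ r) (w₁ ∷ w) s z n N′) z₁
      (λ f′ d′ N′ lt → rhsFrom-afterRight-overdrawn n f′ ε (ε ∙ z₁) (suc ra ∷ r) pr (w₁ ∷ w) s ps′ z d′ N′ lt (ℕP.+-suc k l))
      (ℕP.≤-trans (leadingX₀≤entrySum (suc ra ∷ r)) (ℕP.m≤m+n _ (entrySum s)))
      (λ d′ → shuffle (lettersOf-dropX₀ d′ ε (suc ra ∷ r) (w₁ ∷ w)) V) β ε (ε-/-inv-∙ z₁)
      (λ f′ resp′ d′ N′ le → sumShuffle≡rhsFrom-afterRight n f′ resp′ ε (ε ∙ z₁) (suc ra ∷ r) pr (w₁ ∷ w) s ps′ z d′ N′ le (ℕP.+-suc k l))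
      f resp sb 0 N z≤n (trans (ℕP.+-identityʳ N) (sum-swap (entrySum (suc ra ∷ r)) (suc sb) (entrySum s)))

  eval≡sumList : ∀ f (xs : FSum) → eval f xs ≡ sumList xs (λ (n , u) → n * f u)
  eval≡sumList f []            = refl
  eval≡sumList f ((n , u) ∷ xs) = cong (λ v → n * f u + v) (eval≡sumList f xs)

  eval-⧢η : ∀ f u v → eval f (u ⧢η v) ≡ sumList (shuffle (η⁻¹ u) (η⁻¹ v)) (f ∘ η)
  eval-⧢η f u v = begin
    eval f (u ⧢η v)                                                  ≡⟨ eval≡sumList f (u ⧢η v) ⟩
    sumList (map (λ W → (+ 1 , η W)) Ws) (λ (n , W) → n * f W)       ≡⟨ sumList-map _ Ws _ ⟩
    sumList Ws (λ W → + 1 * f (η W))                                 ≡⟨ sumList-cong Ws (λ W → ℤP.*-identityˡ (f (η W))) ⟩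
    sumList Ws (f ∘ η)                                               ∎
    where
    open ≡-Reasoning
    Ws : List (List Letter)
    Ws = shuffle (η⁻¹ u) (η⁻¹ v)

  eval-rhs : ∀ f (r : Vec ℕ k) w (s : Vec ℕ l) z →
    eval f (rhs k l (toList r) (toList w) (toList s) (toList z))
    ≡ rhsFrom f nothing (+ 0) ε ε r w s z (k ℕ.+ l) (entrySum r ℕ.+ entrySum s)
  eval-rhs {k} {l} f r w s z = begin
    eval f (concatMap termsOf (interleavings k l))
      ≡⟨ eval≡sumList f (concatMap termsOf (interleavings k l)) ⟩
    sumList (concatMap termsOf (interleavings k l)) weigh
      ≡⟨ sumList-concatMap termsOf (interleavings k l) weigh ⟩
    sumList (interleavings k l) (λ e → sumList (termsOf e) weigh)
      ≡⟨ sumList-cong (interleavings k l) (λ e → sumList-map (termOf e) ts weigh) ⟩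
    rhsFrom f nothing (+ 0) ε ε r w s z (k ℕ.+ l) (entrySum r ℕ.+ entrySum s) ∎
    where
    open ≡-Reasoning
    ts : List (List ℕ)
    ts = compositions (k ℕ.+ l) (entrySum r ℕ.+ entrySum s)
    termOf : List Bool → List ℕ → ℤ × BWord
    termOf e t = + coeff (toList r) (toList s) t e , mkWord t (bar (toList w) (toList z) e)
    termsOf : List Bool → FSum
    termsOf e = map (termOf e) ts
    weigh : ℤ × BWord → ℤ
    weigh (n , u) = n * f u

theorem2p2 : {c ℓ : Level} (G : AbelianGroup c ℓ) →
    let open WithGroup G in
    (k l : ℕ) → 1 ≤ k → 1 ≤ l →
    (r : Vec ℕ k) → All (1 ≤_) r → (w : Vec (AbelianGroup.Carrier G) k) →
    (s : Vec ℕ l) → All (1 ≤_) s → (z : Vec (AbelianGroup.Carrier G) l) →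
    (mkWord (toList r) (toList w) ⧢η mkWord (toList s) (toList z))
      ≋ rhs k l (toList r) (toList w) (toList s) (toList z)
theorem2p2 G (suc k) (suc l) _ _ r pr w s ps z f resp = begin
  eval f (mkWord (toList r) (toList w) ⧢η mkWord (toList s) (toList z))
    ≡⟨ eval-⧢η f (mkWord (toList r) (toList w)) (mkWord (toList s) (toList z)) ⟩
  sumList (shuffle (η⁻¹ (mkWord (toList r) (toList w))) (η⁻¹ (mkWord (toList s) (toList z)))) (f ∘ η)
    ≡⟨ sumShuffle≡rhsFrom f resp r pr w s ps z ⟩
  rhsFrom f nothing (+ 0) ε ε r w s z (suc k ℕ.+ suc l) (entrySum r ℕ.+ entrySum s)
    ≡⟨ eval-rhs f r w s z ⟨
  eval f (rhs (suc k) (suc l) (toList r) (toList w) (toList s) (toList z)) ∎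
  where
  open ≡-Reasoning
  open WithGroup G
  open ShuffleExpansion G
  open AbelianGroup G using (ε)
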